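{- Let $\mathcal{D}$ be a derivation of $\Gamma\vdash A$ in $\mathsf{HA}+\mathrm{EM}$, and let $\mathcal{D}^*$ be the term obtained by decorating $\mathcal{D}$ (as described in the context, using the interactive realizability monad). Then $\Gamma\Vdash\mathcal{D}^*:A$ is valid with respect to the interactive realizability semantics, i.e. valid with respect to $\Vdash_T^s$ for every closed $s:\mathrm{State}$.
   Context: System $T'$: types generated from atomic types including $\mathrm{Unit}$, $\mathrm{Nat}$, $\mathrm{State}$, $\mathrm{Ex}$ by $\to,\times,+$; terms of the simply typed $\lambda$-calculus over constants $\mathrm{unit}:\mathrm{Unit}$, $\mathrm{pair}_{X,Y}$, $\pi_1,\pi_2$, $\mathrm{inl},\mathrm{inr}$, $\mathrm{case}:X+Y\to(X\to Z)\to(Y\to Z)\to Z$, $0$, $S$, $R^Z_n:(\mathrm{Nat}\to(\mathrm{Nat}\to Z)\to Z)\to\mathrm{Nat}\to Z$ ($n\in\mathbb{N}\cup\{\infty\}$), $\mathrm{merge}_{\mathrm{Ex}}:\mathrm{Ex}\to\mathrm{Ex}\to\mathrm{Ex}$, and for each $(k+1)$-ary predicate symbol $P$: $\mathrm{query}_P:\mathrm{State}\to\mathrm{Nat}^k\to\mathrm{Unit}+\mathrm{Nat}$, $\mathrm{eval}_P:\mathrm{Nat}^k\to\mathrm{Nat}\to\mathrm{Unit}+\mathrm{Ex}$. Reductions: compatible closure of $\beta$, $\pi_i(\mathrm{pair}\,a_1a_2)\to a_i$, $\mathrm{case}(\mathrm{inl}\,a)fg\to fa$, $\mathrm{case}(\mathrm{inr}\,b)fg\to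 gb$, $R_nh\bar m\to h\bar m(R_mh)$ if $m<n$ or $n=\infty$, else $R_nh\bar m\to d_Z$ (fixed dummy); $\leadsto$ multistep reduction; $\bar n=S^n0$. Arithmetic terms are terms of type Nat; closed ones reduce to numerals of their values. A relation "$e$ properly extends $s$" between closed $e:\mathrm{Ex}$, $s:\mathrm{State}$ is given (intended: the partial state-extension function denoted by $e$ is defined at $s$ and strictly extends it), with (EX): if $e_1,e_2$ properly extend $s$ then so does $\mathrm{merge}_{\mathrm{Ex}}e_1e_2$. For all closed $s$ and $n_i,n\in\mathbb{N}$: (IR1) $\mathrm{query}_Ps\bar n_1\cdots\bar n_k\leadsto\mathrm{inr}\,\bar n$ implies $P(\bar n_1,\dots,\bar n_k,\bar n)$ false; (IR2) $\mathrm{eval}_P\bar n_1\cdots\bar n_k\bar n\leadsto\mathrm{inl}\,\mathrm{unit}$ implies $P(\bar n_1,\dots,\bar n_k,\bar n)$ true; (IR3) $\mathrm{query}_Ps\bar n_1\cdots\bar n_k\leadsto\mathrm{inl}\,\mathrm{unit}$ and $\mathrm{eval}_P\bar n_1\cdots\bar n_k\bar n\leadsto\mathrm{inr}\,e$ imply $e$ properly extends $s$. Monad: $TX=\mathrm{State}\to(X+\mathrm{Ex})$; $\mathrm{unit}_X=\lambda x.\lambda\_{:}\mathrm{State}.\mathrm{inl}\,x$; $\mathrm{star}=\lambda f.\lambda m.\lambda s.\mathrm{case}(ms)(\lambda x.fxs)\,\mathrm{inr}$; $\mathrm{merge}=\lambda m.\lambda n.\lambda s.\mathrm{case}(ms)(\lambda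 x.\mathrm{case}(ns)(\lambda y.\mathrm{inl}(\mathrm{pair}\,x\,y))\mathrm{inr})(\lambda e_1.\mathrm{case}(ns)(\lambda\_.\mathrm{inr}\,e_1)(\lambda e_2.\mathrm{inr}(\mathrm{merge}_{\mathrm{Ex}}e_1e_2)))$. $\mathrm{star}^0=\lambda f.f$, $\mathrm{star}^1=\mathrm{star}$, $\mathrm{star}^{k+2}=\lambda f.\lambda x.\lambda y.\mathrm{star}^{k+1}(\lambda z.f(\pi_1z)(\pi_2z))(\mathrm{merge}\,x\,y)$; $\mathrm{raise}^k=\lambda f.\mathrm{star}^k(\lambda x_1\dots\lambda x_k.\mathrm{unit}(fx_1\cdots x_k))$. Formulas: from atomic formulas (including $\bot$, never true) by $\wedge,\vee,\to,\forall,\exists$; $\neg A:=A\to\bot$. $|P|=\mathrm{Unit}$, $|B\wedge C|=|B|\times|C|$, $|B\vee C|=|B|+|C|$, $|\exists xB|=\mathrm{Nat}\times|B|$, $|B\to C|=|B|\to\|C\|$, $|\forall xB|=\mathrm{Nat}\to\|B\|$, $\|A\|=T|A|$. For closed $s:\mathrm{State}$: $r\Vdash_T^sA$ iff $rs\leadsto\mathrm{inl}\,r'$ with $r'\Vdash^sA$ or $rs\leadsto\mathrm{inr}\,e$ with $e$ properly extending $s$; $r\Vdash^sP$ iff $r\leadsto\mathrm{unit}$ and $P$ true; $r\Vdash^sB\wedge C$ iff $\pi_1r\Vdash^sB$, $\pi_2r\Vdash^sC$; $r\Vdash^sB\vee C$ iff $r\leadsto\mathrm{inl}\,a$, $a\Vdash^sB$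 or $r\leadsto\mathrm{inr}\,b$, $b\Vdash^sC$; $r\Vdash^sB\to C$ iff $rp\Vdash_T^sC$ whenever $p\Vdash^sB$; $r\Vdash^s\forall xB$ iff $r\bar n\Vdash_T^sB[x:=\bar n]$ for all $n$; $r\Vdash^s\exists xB$ iff $\pi_2r\Vdash^sB[x:=\pi_1r]$. A decorated sequent $\alpha_1:A_1,\dots,\alpha_k:A_k\Vdash r:B$ ($\alpha_i:|A_i|$, $r:\|B\|$, free arithmetic variables among $x_1,\dots,x_l$) is valid w.r.t. $\Vdash_T^s$ if for all $n_1,\dots,n_l$ and closed $p_i\Vdash^sA_i[\vec x:=\vec{\bar n}]$, $r[\vec x:=\vec{\bar n},\vec\alpha:=\vec p]\Vdash_T^sB[\vec x:=\vec{\bar n}]$. $\mathsf{HA}+\mathrm{EM}$: natural deduction $\mathsf{HA}$ plus axioms $\mathrm{EM}(P,t_1,\dots,t_k)\equiv\forall yP(t_1,\dots,t_k,y)\vee\exists y\neg P(t_1,\dots,t_k,y)$. Decorated rules (usual eigenvariable conditions): Id: $\Gamma\Vdash\mathrm{raise}^0\alpha_i:A_i$. Atm (atomic rule with premises $P_1..P_l$, conclusion $P$): from $r_i:P_i$ infer $\mathrm{raise}^l(\lambda\gamma_1{:}\mathrm{Unit}\dots\lambda\gamma_l{:}\mathrm{Unit}.\mathrm{unit})r_1\cdots r_l:P$. $\wedge$I: $\mathrm{raise}^2\mathrm{pair}\,r_1r_2$. $\wedge$E: $\mathrm{raise}^1\pi_1r$, $\mathrm{raise}^1\pi_2r$. $\vee$I: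 $\mathrm{raise}^1\mathrm{inl}\,r$, $\mathrm{raise}^1\mathrm{inr}\,r$. $\vee$E: from $\Gamma\Vdash r:A\vee B$, $\Gamma,\alpha:A\Vdash p:C$, $\Gamma,\alpha:B\Vdash q:C$ infer $\mathrm{star}^1(\lambda\gamma.\mathrm{case}\,\gamma(\lambda\alpha{:}|A|.p)(\lambda\alpha{:}|B|.q))r:C$. $\to$I: $\mathrm{raise}^0(\lambda\alpha{:}|A|.r)$. $\to$E: $\mathrm{star}^2(\lambda\gamma_1.\lambda\gamma_2.\gamma_1\gamma_2)rp$. $\forall$I: $\mathrm{raise}^0(\lambda x{:}\mathrm{Nat}.r)$. $\forall$E: $\mathrm{star}^1(\lambda\gamma.\gamma t)r:A[x:=t]$. $\exists$I: from $r:A[x:=t]$, $\mathrm{raise}^1(\lambda\gamma.\mathrm{pair}\,t\,\gamma)r:\exists xA$. $\exists$E: from $r_1:\exists xA$ and $\Gamma,\alpha:A[x:=y]\Vdash r_2:C$, $\mathrm{star}^1(\lambda\gamma.(\lambda y.\lambda\alpha.r_2)(\pi_1\gamma)(\pi_2\gamma))r_1:C$. Ind: from $\Gamma,\alpha:\forall z(z<y\to A[x:=z])\Vdash r:A[x:=y]$ infer $\mathrm{raise}^0(R_\infty f):\forall xA$, $f\equiv\lambda y{:}\mathrm{Nat}.\lambda\beta{:}\mathrm{Nat}\to T|A|.(\lambda\alpha.r)(\lambda z{:}\mathrm{Nat}.\mathrm{raise}^0(\lambda\_{:}\mathrm{Unit}.\beta z))$. EM: $\Gamma\Vdash\mathrm{em}(P,\vec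 t):\mathrm{EM}(P,\vec t)$ with $\mathrm{em}(P,\vec t)\equiv\lambda s{:}\mathrm{State}.\mathrm{inl}(\mathrm{case}(\mathrm{query}_Ps\,t_1\cdots t_k)(\lambda\_.\mathrm{inl}(\lambda y{:}\mathrm{Nat}.\lambda\_{:}\mathrm{State}.\mathrm{eval}_Pt_1\cdots t_ky))(\lambda y.\mathrm{inr}(\mathrm{pair}\,y\,\mathrm{unit}_{\mathrm{Unit}})))$. $\mathcal{D}^*$ is the term in the decorated conclusion. -}

module Defs where

open import Data.Nat using (ℕ; zero; suc; _<_; _≤_)
open import Data.List using (List; []; _∷_; length)
open import Data.Vec using (Vec; []; _∷_; replicate; _∷ʳ_)
import Data.Vec as V
open import Data.Vec.Relation.Binary.Pointwise.Inductive using (Pointwise)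
open import Data.List.Relation.Unary.All using (All)
open import Data.Product using (Σ; _×_; _,_; ∃)
open import Data.Sum using (_⊎_)
open import Data.Empty using (⊥)
open import Data.Unit using (⊤)
open import Relation.Nullary using (¬_)
open import Relation.Binary.PropositionalEquality using (_≡_)
open import Relation.Binary.Construct.Closure.ReflexiveTransitive using (Star)

infixr 5 _⇒_
infixr 7 _⊗_
infixr 6 _⊕_

data Ty : Set where
  Unit Nat State Ex : Ty
  _⇒_ _⊗_ _⊕_ : Ty → Ty → Ty

T : Ty → Ty
T X = State ⇒ (X ⊕ Ex)

NatsArr : ℕ → Ty → Ty
NatsArr zero    Y = Y
NatsArr (suc k) Y = Nat ⇒ NatsArr k Y

_⇛_ : ∀ {k} → Vec Ty k → Ty → Ty
[]       ⇛ Y = Y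
(X ∷ Xs) ⇛ Y = X ⇒ (Xs ⇛ Y)

mapT : ∀ {k} → Vec Ty k → Vec Ty k
mapT = V.map T

data ℕ∞ : Set where
  fin : ℕ → ℕ∞
  ∞   : ℕ∞

_<∞_ : ℕ → ℕ∞ → Set
m <∞ fin n = m < n
m <∞ ∞     = ⊤

-- Syntactic signature: predicate symbols (PSym k = the (k+1)-ary ones),
-- the distinguished binary symbol < used by induction, and further
-- (optional) constants of atomic types, e.g. constants for states.
-- dS, dE are the constants used as dummies d_State, d_Ex.

record Sig : Set₁ where
  field
    PSym : ℕ → Set
    lt   : PSym 1
    XC   : Ty → Set
    dS   : XC State
    dE   : XC Ex

Ctx : Set
Ctx = List Ty

data _∋_ : Ctx → Ty → Set where
  here  : ∀ {Γ A} → (A ∷ Γ) ∋ A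
  there : ∀ {Γ A B} → Γ ∋ A → (B ∷ Γ) ∋ A

Nats : ℕ → Ctx
Nats zero    = []
Nats (suc n) = Nat ∷ Nats n

module _ (sg : Sig) where
  open Sig sg

  data Const : Ty → Set where
    unitc    : Const Unit
    pairc    : ∀ {X Y} → Const (X ⇒ Y ⇒ X ⊗ Y)
    π₁c      : ∀ {X Y} → Const (X ⊗ Y ⇒ X)
    π₂c      : ∀ {X Y} → Const (X ⊗ Y ⇒ Y)
    inlc     : ∀ {X Y} → Const (X ⇒ X ⊕ Y)
    inrc     : ∀ {X Y} → Const (Y ⇒ X ⊕ Y)
    casec    : ∀ {X Y Z} → Const (X ⊕ Y ⇒ (X ⇒ Z) ⇒ (Y ⇒ Z) ⇒ Z)
    zeroc    : Const Nat
    succ     : Const (Nat ⇒ Nat)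
    recc     : ∀ {Z} → ℕ∞ → Const ((Nat ⇒ (Nat ⇒ Z) ⇒ Z) ⇒ Nat ⇒ Z)
    mergeExc : Const (Ex ⇒ Ex ⇒ Ex)
    queryc   : ∀ {k} → PSym k → Const (State ⇒ NatsArr k (Unit ⊕ Nat))
    evalc    : ∀ {k} → PSym k → Const (NatsArr k (Nat ⇒ Unit ⊕ Ex))
    extc     : ∀ {A} → XC A → Const A

  data Tm (Γ : Ctx) : Ty → Set where
    var : ∀ {A} → Γ ∋ A → Tm Γ A
    lam : ∀ {A B} → Tm (A ∷ Γ) B → Tm Γ (A ⇒ B)
    app : ∀ {A B} → Tm Γ (A ⇒ B) → Tm Γ A → Tm Γ B
    con : ∀ {A} → Const A → Tm Γ A

  Ren : Ctx → Ctx → Set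
  Ren Γ Δ = ∀ {A} → Γ ∋ A → Δ ∋ A

  ext : ∀ {Γ Δ B} → Ren Γ Δ → Ren (B ∷ Γ) (B ∷ Δ)
  ext ρ here      = here
  ext ρ (there x) = there (ρ x)

  ren : ∀ {Γ Δ A} → Ren Γ Δ → Tm Γ A → Tm Δ A
  ren ρ (var x)   = var (ρ x)
  ren ρ (lam t)   = lam (ren (ext ρ) t)
  ren ρ (app t u) = app (ren ρ t) (ren ρ u)
  ren ρ (con c)   = con c

  wk : ∀ {Γ A B} → Tm Γ A → Tm (B ∷ Γ) A
  wk = ren there

  Sub : Ctx → Ctx → Set
  Sub Γ Δ = ∀ {A} → Γ ∋ A → Tm Δ A

  exts : ∀ {Γ Δ B} → Sub Γ Δ → Sub (B ∷ Γ) (B ∷ Δ)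
  exts σ here      = var here
  exts σ (there x) = wk (σ x)

  sub : ∀ {Γ Δ A} → Sub Γ Δ → Tm Γ A → Tm Δ A
  sub σ (var x)   = σ x
  sub σ (lam t)   = lam (sub (exts σ) t)
  sub σ (app t u) = app (sub σ t) (sub σ u)
  sub σ (con c)   = con c

  _▸_ : ∀ {Γ Δ A} → Sub Γ Δ → Tm Δ A → Sub (A ∷ Γ) Δ
  (σ ▸ t) here      = t
  (σ ▸ t) (there x) = σ x

  _[_] : ∀ {Γ A B} → Tm (B ∷ Γ) A → Tm Γ B → Tm Γ A
  t [ u ] = sub (var ▸ u) t

  num : ∀ {Γ} → ℕ → Tm Γ Nat
  num zero    = con zeroc
  num (suc n) = app (con succ) (num n)

  appsN : ∀ {Γ k B} → Tm Γ (NatsArr k B) → Vec (Tm Γ Nat) k → Tm Γ B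
  appsN f []       = f
  appsN f (t ∷ ts) = appsN (app f t) ts

  queryT : ∀ {k} → PSym k → Tm [] State → Vec ℕ k → Tm [] (Unit ⊕ Nat)
  queryT P s ns = appsN (app (con (queryc P)) s) (V.map num ns)

  evalT : ∀ {k} → PSym k → Vec ℕ k → ℕ → Tm [] (Unit ⊕ Ex)
  evalT P ns m = app (appsN (con (evalc P)) (V.map num ns)) (num m)

  v0 : ∀ {Γ A} → Tm (A ∷ Γ) A
  v0 = var here
  v1 : ∀ {Γ A B} → Tm (B ∷ A ∷ Γ) A
  v1 = var (there here)
  v2 : ∀ {Γ A B C} → Tm (C ∷ B ∷ A ∷ Γ) A
  v2 = var (there (there here))
  v3 : ∀ {Γ A B C D} → Tm (D ∷ C ∷ B ∷ A ∷ Γ) A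
  v3 = var (there (there (there here)))

  π1 : ∀ {Γ X Y} → Tm Γ (X ⊗ Y) → Tm Γ X
  π1 = app (con π₁c)
  π2 : ∀ {Γ X Y} → Tm Γ (X ⊗ Y) → Tm Γ Y
  π2 = app (con π₂c)
  pair : ∀ {Γ X Y} → Tm Γ X → Tm Γ Y → Tm Γ (X ⊗ Y)
  pair a b = app (app (con pairc) a) b
  inl : ∀ {Γ X Y} → Tm Γ X → Tm Γ (X ⊕ Y)
  inl = app (con inlc)
  inr : ∀ {Γ X Y} → Tm Γ Y → Tm Γ (X ⊕ Y)
  inr = app (con inrc)
  case : ∀ {Γ X Y Z} → Tm Γ (X ⊕ Y) → Tm Γ (X ⇒ Z) → Tm Γ (Y ⇒ Z) → Tm Γ Z
  case a f g = app (app (app (con casec) a) f) g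

  dummy : ∀ {Γ} (Z : Ty) → Tm Γ Z
  dummy Unit    = con unitc
  dummy Nat     = con zeroc
  dummy State   = con (extc dS)
  dummy Ex      = con (extc dE)
  dummy (A ⇒ B) = lam (dummy B)
  dummy (A ⊗ B) = pair (dummy A) (dummy B)
  dummy (A ⊕ B) = inl (dummy A)

  unitM : ∀ {Γ X} → Tm Γ (X ⇒ T X)
  unitM = lam (lam (inl v1))

  starM : ∀ {Γ X Y} → Tm Γ ((X ⇒ T Y) ⇒ T X ⇒ T Y)
  starM = lam (lam (lam (case (app v1 v0) (lam (app (app v3 v0) v1)) (con inrc))))

  mergeM : ∀ {Γ X Y} → Tm Γ (T X ⇒ T Y ⇒ T (X ⊗ Y))
  mergeM = lam (lam (lam
    (case (app v2 v0)
      (lam (case (app v2 v1) (lam (inl (pair v1 v0))) (con inrc)))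
      (lam (case (app v2 v1) (lam (inr v1))
                 (lam (inr (app (app (con mergeExc) v1) v0))))))))

  starK : ∀ {Γ k} (Xs : Vec Ty k) (Y : Ty) → Tm Γ ((Xs ⇛ T Y) ⇒ (mapT Xs ⇛ T Y))
  starK {k = zero} [] Y = lam v0
  starK {k = suc zero} (X ∷ []) Y = starM
  starK {k = suc (suc k)} (X ∷ X' ∷ Xs) Y =
    lam (lam (lam (app (app (starK ((X ⊗ X') ∷ Xs) Y)
                             (lam (app (app v3 (π1 v0)) (π2 v0))))
                       (app (app mergeM v1) v0))))

  liftUnit : ∀ {Γ k} (Xs : Vec Ty k) {Y : Ty} → Tm Γ (Xs ⇛ Y) → Tm Γ (Xs ⇛ T Y)
  liftUnit []       f = app unitM f
  liftUnit (X ∷ Xs) f = lam (liftUnit Xs (app (wk f) v0))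

  raiseK : ∀ {Γ k} (Xs : Vec Ty k) (Y : Ty) → Tm Γ ((Xs ⇛ Y) ⇒ (mapT Xs ⇛ T Y))
  raiseK Xs Y = lam (app (starK Xs Y) (liftUnit Xs v0))

  -- Fm n X : formulas with free
  -- variables among x_0..x_{n-1} whose realizer type |A| is X.

  ArTm : ℕ → Set
  ArTm n = Tm (Nats n) Nat

  data Atom (n : ℕ) : Set where
    ⊥a : Atom n
    pr : ∀ {k} → PSym k → Vec (ArTm n) (suc k) → Atom n

  infixr 4 _∧'_ _∨'_
  infixr 3 _⟹_
  data Fm (n : ℕ) : Ty → Set where
    at   : Atom n → Fm n Unit
    _∧'_ : ∀ {X Y} → Fm n X → Fm n Y → Fm n (X ⊗ Y)
    _∨'_ : ∀ {X Y} → Fm n X → Fm n Y → Fm n (X ⊕ Y)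
    _⟹_  : ∀ {X Y} → Fm n X → Fm n Y → Fm n (X ⇒ T Y)
    fall : ∀ {X} → Fm (suc n) X → Fm n (Nat ⇒ T X)
    fex  : ∀ {X} → Fm (suc n) X → Fm n (Nat ⊗ X)

  ∣_∣ : ∀ {n X} → Fm n X → Ty
  ∣_∣ {X = X} _ = X

  ¬' : ∀ {n X} → Fm n X → Fm n (X ⇒ T Unit)
  ¬' A = A ⟹ at ⊥a

  subA : ∀ {n m} → Sub (Nats n) (Nats m) → Atom n → Atom m
  subA σ ⊥a        = ⊥a
  subA σ (pr P ts) = pr P (V.map (sub σ) ts)

  subF : ∀ {n m X} → Sub (Nats n) (Nats m) → Fm n X → Fm m X
  subF σ (at a)   = at (subA σ a)
  subF σ (A ∧' B) = subF σ A ∧' subF σ B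
  subF σ (A ∨' B) = subF σ A ∨' subF σ B
  subF σ (A ⟹ B)  = subF σ A ⟹ subF σ B
  subF σ (fall A) = fall (subF (exts σ) A)
  subF σ (fex A)  = fex (subF (exts σ) A)

  wkF : ∀ {n X} → Fm n X → Fm (suc n) X
  wkF = subF (λ x → var (there x))

  _[_]F : ∀ {n X} → Fm (suc n) X → ArTm n → Fm n X
  A [ t ]F = subF (var ▸ t) A

  -- course-of-values induction hypothesis ∀z (z < y → A[x:=z]),
  -- for A : Fm (suc n) with x = y = variable 0
  IH : ∀ {n X} → Fm (suc n) X → Fm (suc n) (Nat ⇒ T (Unit ⇒ T X))
  IH A = fall (at (pr lt (v0 ∷ v1 ∷ [])) ⟹ subF σ A)
    where
      σ : Sub (Nats (suc _)) (Nats (suc (suc _)))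
      σ here      = var here
      σ (there x) = var (there (there x))

  EMF : ∀ {n k} → PSym k → Vec (ArTm n) k →
        Fm n ((Nat ⇒ T Unit) ⊕ (Nat ⊗ (Unit ⇒ T Unit)))
  EMF P ts = fall (at (pr P (V.map wk ts ∷ʳ v0)))
          ∨' fex (¬' (at (pr P (V.map wk ts ∷ʳ v0))))

  Hyps : ℕ → Set
  Hyps n = List (Σ Ty (Fm n))

  ctxOf : ∀ {n} → Hyps n → Ctx
  ctxOf {n} []            = Nats n
  ctxOf ((X , A) ∷ Γ)     = X ∷ ctxOf Γ

  wkH : ∀ {n} → Hyps n → Hyps (suc n)
  wkH []            = []
  wkH ((X , A) ∷ Γ) = (X , wkF A) ∷ wkH Γ

  data HVar : ∀ {n} → Hyps n → ∀ {X} → Fm n X → Set where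
    hz : ∀ {n X} {A : Fm n X} {Γ} → HVar ((X , A) ∷ Γ) A
    hs : ∀ {n X Y} {A : Fm n X} {B : Fm n Y} {Γ} → HVar Γ A → HVar ((Y , B) ∷ Γ) A

  hv : ∀ {n} {Γ : Hyps n} {X} {A : Fm n X} → HVar Γ A → ctxOf Γ ∋ X
  hv hz     = here
  hv (hs i) = there (hv i)

  embN : ∀ {n} (Γ : Hyps n) → Ren (Nats n) (ctxOf Γ)
  embN []      x = x
  embN (_ ∷ Γ) x = there (embN Γ x)

  -- moving the new eigenvariable to the front
  ρ∀ : ∀ {n} (Γ : Hyps n) → Ren (ctxOf (wkH Γ)) (Nat ∷ ctxOf Γ)
  ρ∀ []      x         = x
  ρ∀ (_ ∷ Γ) here      = there here
  ρ∀ (_ ∷ Γ) (there x) = shift (ρ∀ Γ x)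
    where
      shift : ∀ {A B Δ} → (Nat ∷ Δ) ∋ A → (Nat ∷ B ∷ Δ) ∋ A
      shift here      = here
      shift (there y) = there (there y)

  ins1 : ∀ {Δ A B C} → (A ∷ Δ) ∋ C → (A ∷ B ∷ Δ) ∋ C
  ins1 here      = here
  ins1 (there y) = there (there y)

-- Further data of the system: extra reduction rules δ (the computation
-- rules of query_P, eval_P, merge_Ex and of the extra constants), the
-- atomic rules of HA, and the interpretation of predicate symbols.

record Sys (sg : Sig) : Set₁ where
  open Sig sg
  field
    δ    : ∀ {Γ A} → Tm sg Γ A → Tm sg Γ A → Set
    Rule : ∀ n → List (Atom sg n) → Atom sg n → Set
    ⟦_⟧  : ∀ {k} → PSym k → Vec ℕ (suc k) → Set

module _ (sg : Sig) (S : Sys sg) where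
  open Sig sg
  open Sys S

  infix 3 _⟶_ _⇝_
  data _⟶_ {Γ : Ctx} : ∀ {A} → Tm sg Γ A → Tm sg Γ A → Set where
    β    : ∀ {A B} {t : Tm sg (A ∷ Γ) B} {u} → app (lam t) u ⟶ _[_] sg t u
    π₁β  : ∀ {X Y} {a : Tm sg Γ X} {b : Tm sg Γ Y} → π1 sg (pair sg a b) ⟶ a
    π₂β  : ∀ {X Y} {a : Tm sg Γ X} {b : Tm sg Γ Y} → π2 sg (pair sg a b) ⟶ b
    caseL : ∀ {X Y Z} {a : Tm sg Γ X} {f : Tm sg Γ (X ⇒ Z)} {g : Tm sg Γ (Y ⇒ Z)} →
            case sg (inl sg a) f g ⟶ app f a
    caseR : ∀ {X Y Z} {b : Tm sg Γ Y} {f : Tm sg Γ (X ⇒ Z)} {g : Tm sg Γ (Y ⇒ Z)} →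
            case sg (inr sg b) f g ⟶ app g b
    recS : ∀ {Z} {n : ℕ∞} {h : Tm sg Γ (Nat ⇒ (Nat ⇒ Z) ⇒ Z)} (m : ℕ) → m <∞ n →
           app (app (con (recc n)) h) (num sg m) ⟶
             app (app h (num sg m)) (app (con (recc (fin m))) h)
    recD : ∀ {Z} {n : ℕ} {h : Tm sg Γ (Nat ⇒ (Nat ⇒ Z) ⇒ Z)} (m : ℕ) → n ≤ m →
           app (app (con (recc (fin n))) h) (num sg m) ⟶ dummy sg Z
    δs   : ∀ {A} {t u : Tm sg Γ A} → δ t u → t ⟶ u
    ξl   : ∀ {A B} {t t' : Tm sg Γ (A ⇒ B)} {u} → t ⟶ t' → app t u ⟶ app t' u
    ξr   : ∀ {A B} {t : Tm sg Γ (A ⇒ B)} {u u'} → u ⟶ u' → app t u ⟶ app t u'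
    ξλ   : ∀ {A B} {t t' : Tm sg (A ∷ Γ) B} → t ⟶ t' → lam t ⟶ lam t'

  _⇝_ : ∀ {Γ A} → Tm sg Γ A → Tm sg Γ A → Set
  _⇝_ = Star _⟶_

  data Der : ∀ {n} → Hyps sg n → ∀ {X} → Fm sg n X → Set
  data Ders : ∀ {n} → Hyps sg n → List (Atom sg n) → Set

  data Ders where
    []  : ∀ {n} {Γ : Hyps sg n} → Ders Γ []
    _∷_ : ∀ {n} {Γ : Hyps sg n} {a as} → Der Γ (at a) → Ders Γ as → Ders Γ (a ∷ as)

  data Der where
    idR  : ∀ {n Γ X} {A : Fm sg n X} → HVar sg Γ A → Der Γ A
    atmR : ∀ {n Γ Ps P} → Rule n Ps P → Ders Γ Ps → Der Γ (at P)
    ∧I   : ∀ {n Γ X Y} {A : Fm sg n X} {B : Fm sg n Y} → Der Γ A → Der Γ B → Der Γ (A ∧' B)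
    ∧E₁  : ∀ {n Γ X Y} {A : Fm sg n X} {B : Fm sg n Y} → Der Γ (A ∧' B) → Der Γ A
    ∧E₂  : ∀ {n Γ X Y} {A : Fm sg n X} {B : Fm sg n Y} → Der Γ (A ∧' B) → Der Γ B
    ∨I₁  : ∀ {n Γ X Y} {A : Fm sg n X} {B : Fm sg n Y} → Der Γ A → Der Γ (A ∨' B)
    ∨I₂  : ∀ {n Γ X Y} {A : Fm sg n X} {B : Fm sg n Y} → Der Γ B → Der Γ (A ∨' B)
    ∨E   : ∀ {n Γ X Y Z} {A : Fm sg n X} {B : Fm sg n Y} {C : Fm sg n Z} →
           Der Γ (A ∨' B) → Der ((X , A) ∷ Γ) C → Der ((Y , B) ∷ Γ) C → Der Γ C
    ⟹I   : ∀ {n Γ X Y} {A : Fm sg n X} {B : Fm sg n Y} → Der ((X , A) ∷ Γ) B → Der Γ (A ⟹ B)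
    ⟹E   : ∀ {n Γ X Y} {A : Fm sg n X} {B : Fm sg n Y} → Der Γ (A ⟹ B) → Der Γ A → Der Γ B
    -- eigenvariable condition: x (= variable 0) not free in Γ
    ∀I   : ∀ {n Γ X} {A : Fm sg (suc n) X} → Der (wkH sg Γ) A → Der Γ (fall A)
    ∀E   : ∀ {n Γ X} {A : Fm sg (suc n) X} → Der Γ (fall A) → (t : ArTm sg n) →
           Der Γ (_[_]F sg A t)
    ∃I   : ∀ {n Γ X} {A : Fm sg (suc n) X} (t : ArTm sg n) → Der Γ (_[_]F sg A t) →
           Der Γ (fex A)
    -- eigenvariable condition: y (= variable 0) not free in Γ, C
    ∃E   : ∀ {n Γ X Y} {A : Fm sg (suc n) X} {C : Fm sg n Y} →
           Der Γ (fex A) → Der ((X , A) ∷ wkH sg Γ) (wkF sg C) → Der Γ C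
    -- from Γ, ∀z(z<y → A[x:=z]) ⊢ A[x:=y]  (y fresh) infer ∀x A
    ind  : ∀ {n Γ X} {A : Fm sg (suc n) X} →
           Der ((_ , IH sg A) ∷ wkH sg Γ) A → Der Γ (fall A)
    em   : ∀ {n Γ k} (P : PSym k) (ts : Vec (ArTm sg n) k) → Der Γ (EMF sg P ts)

  lamsU : ∀ {Γ} l → Tm sg Γ (replicate l Unit ⇛ Unit)
  lamsU zero    = con unitc
  lamsU (suc l) = lam (lamsU l)

  appsT : ∀ {Γ B} l → Tm sg Γ (mapT (replicate l Unit) ⇛ B) → Vec (Tm sg Γ (T Unit)) l → Tm sg Γ B
  appsT zero    f []       = f
  appsT (suc l) f (r ∷ rs) = appsT l (app f r) rs

  dec  : ∀ {n} {Γ : Hyps sg n} {X} {A : Fm sg n X} → Der Γ A → Tm sg (ctxOf sg Γ) (T X)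
  decs : ∀ {n} {Γ : Hyps sg n} {Ps} → Ders Γ Ps → Vec (Tm sg (ctxOf sg Γ) (T Unit)) (length Ps)

  decs []       = []
  decs (d ∷ ds) = dec d ∷ decs ds

  dec (idR i) = app (raiseK sg [] _) (var (hv sg i))
  dec (atmR {Ps = Ps} r ds) =
    appsT (length Ps) (app (raiseK sg (replicate (length Ps) Unit) Unit) (lamsU (length Ps))) (decs ds)
  dec (∧I {X = X} {Y} d e) =
    app (app (app (raiseK sg (X ∷ Y ∷ []) (X ⊗ Y)) (con pairc)) (dec d)) (dec e)
  dec (∧E₁ {X = X} {Y} d) = app (app (raiseK sg ((X ⊗ Y) ∷ []) X) (con π₁c)) (dec d)
  dec (∧E₂ {X = X} {Y} d) = app (app (raiseK sg ((X ⊗ Y) ∷ []) Y) (con π₂c)) (dec d)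
  dec (∨I₁ {X = X} {Y} d) = app (app (raiseK sg (X ∷ []) (X ⊕ Y)) (con inlc)) (dec d)
  dec (∨I₂ {X = X} {Y} d) = app (app (raiseK sg (Y ∷ []) (X ⊕ Y)) (con inrc)) (dec d)
  dec (∨E {X = X} {Y} {Z} d p q) =
    app (app (starK sg ((X ⊕ Y) ∷ []) Z)
             (lam (case sg (v0 sg) (lam (ren sg (ext sg there) (dec p)))
                                   (lam (ren sg (ext sg there) (dec q))))))
        (dec d)
  dec (⟹I d) = app (raiseK sg [] _) (lam (dec d))
  dec (⟹E {X = X} {Y} d e) =
    app (app (app (starK sg ((X ⇒ T Y) ∷ X ∷ []) Y) (lam (lam (app (v1 sg) (v0 sg))))) (dec d)) (dec e)
  dec (∀I {Γ = Γ} d) = app (raiseK sg [] _) (lam (ren sg (ρ∀ sg Γ) (dec d)))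
  dec (∀E {Γ = Γ} {X} d t) =
    app (app (starK sg ((Nat ⇒ T X) ∷ []) X)
             (lam (app (v0 sg) (wk sg (ren sg (embN sg Γ) t)))))
        (dec d)
  dec (∃I {Γ = Γ} {X} t d) =
    app (app (raiseK sg (X ∷ []) (Nat ⊗ X))
             (lam (pair sg (wk sg (ren sg (embN sg Γ) t)) (v0 sg))))
        (dec d)
  dec (∃E {Γ = Γ} {X} {Y} d e) =
    app (app (starK sg ((Nat ⊗ X) ∷ []) Y)
             (lam (app (app (lam (lam (ren sg (ext sg (λ x → ins1 sg (ρ∀ sg Γ x))) (dec e))))
                            (π1 sg (v0 sg)))
                       (π2 sg (v0 sg)))))
        (dec d)
  dec (ind {Γ = Γ} {X} d) =
    app (raiseK sg [] _) (app (con (recc {Z = T X} ∞)) f)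
    where
      f : Tm sg (ctxOf sg Γ) (Nat ⇒ (Nat ⇒ T X) ⇒ T X)
      f = lam (lam (app (lam (ren sg (ext sg (λ x → there (ρ∀ sg Γ x))) (dec d)))
                        (lam (app (raiseK sg [] (Unit ⇒ T X)) (lam (app (v2 sg) (v1 sg)))))))
  dec (em {Γ = Γ} P ts) =
    lam (inl sg (case sg (appsN sg (app (con (queryc P)) (v0 sg)) (V.map (λ t → wk sg (emb t)) ts))
                   (lam (inl sg (lam (lam (app (appsN sg (con (evalc P))
                                                  (V.map (λ t → wk sg (wk sg (wk sg (wk sg (emb t))))) ts))
                                               (v1 sg))))))
                   (lam (inr sg (pair sg (v0 sg) (unitM sg))))))
    where
      emb : ArTm sg _ → Tm sg (ctxOf sg Γ) Nat
      emb = ren sg (embN sg Γ)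

  -- A closed formula is represented
  -- as a formula with n free variables together with a closing
  -- substitution ρ of closed Nat terms (so "A[ρ]").

  TrueA : ∀ {n} → Sub sg (Nats n) [] → Atom sg n → Set
  TrueA ρ ⊥a        = ⊥
  TrueA ρ (pr P ts) = Σ (Vec ℕ _) λ ns →
    Pointwise (λ t m → t ⇝ num sg m) (V.map (sub sg ρ) ts) ns × ⟦ P ⟧ ns

  numEnv : ∀ {n} → Vec ℕ n → Sub sg (Nats n) []
  numEnv (m ∷ ns) here      = num sg m
  numEnv (m ∷ ns) (there x) = numEnv ns x

record Assumptions (sg : Sig) (S : Sys sg) : Set₁ where
  open Sig sg
  open Sys S
  field
    _properlyExtends_ : Tm sg [] Ex → Tm sg [] State → Set
    EX : ∀ {e₁ e₂ s} → e₁ properlyExtends s → e₂ properlyExtends s →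
         app (app (con mergeExc) e₁) e₂ properlyExtends s
    lt-sound : ∀ a b → ⟦ lt ⟧ (a ∷ b ∷ []) → a < b
    lt-complete : ∀ a b → a < b → ⟦ lt ⟧ (a ∷ b ∷ [])
    rule-sound : ∀ {n Ps P} → Rule n Ps P → (ns : Vec ℕ n) →
                 All (TrueA sg S (numEnv sg S ns)) Ps → TrueA sg S (numEnv sg S ns) P
    NUM  : (t : Tm sg [] Nat) → ∃ λ m → _⇝_ sg S t (num sg m)
    UNIQ : ∀ {t : Tm sg [] Nat} {m m'} → _⇝_ sg S t (num sg m) → _⇝_ sg S t (num sg m') → m ≡ m'
    query-total : ∀ {k} (P : PSym k) (s : Tm sg [] State) (ns : Vec ℕ k) →
      _⇝_ sg S (queryT sg P s ns) (inl sg (con unitc))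
      ⊎ ∃ λ m → _⇝_ sg S (queryT sg P s ns) (inr sg (num sg m))
    eval-total : ∀ {k} (P : PSym k) (ns : Vec ℕ k) (m : ℕ) →
      _⇝_ sg S (evalT sg P ns m) (inl sg (con unitc))
      ⊎ ∃ λ e → _⇝_ sg S (evalT sg P ns m) (inr sg e)
    IR1 : ∀ {k} (P : PSym k) (s : Tm sg [] State) (ns : Vec ℕ k) (m : ℕ) →
      _⇝_ sg S (queryT sg P s ns) (inr sg (num sg m)) →
      ¬ ⟦ P ⟧ (ns ∷ʳ m)
    IR2 : ∀ {k} (P : PSym k) (ns : Vec ℕ k) (m : ℕ) →
      _⇝_ sg S (evalT sg P ns m) (inl sg (con unitc)) →
      ⟦ P ⟧ (ns ∷ʳ m)
    IR3 : ∀ {k} (P : PSym k) (s : Tm sg [] State) (ns : Vec ℕ k) (m : ℕ) (e : Tm sg [] Ex) →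
      _⇝_ sg S (queryT sg P s ns) (inl sg (con unitc)) →
      _⇝_ sg S (evalT sg P ns m) (inr sg e) →
      e properlyExtends s

module _ (sg : Sig) (S : Sys sg) (H : Assumptions sg S) where
  open Assumptions H

  private
    _⇝'_ : ∀ {Γ A} → Tm sg Γ A → Tm sg Γ A → Set
    _⇝'_ = _⇝_ sg S

  -- Real s ρ A r   means   r ⊩^s A[ρ]
  Real  : ∀ {n} (s : Tm sg [] State) (ρ : Sub sg (Nats n) []) {X} → Fm sg n X → Tm sg [] X → Set
  -- RealT s ρ A r  means   r ⊩_T^s A[ρ]
  RealT : ∀ {n} (s : Tm sg [] State) (ρ : Sub sg (Nats n) []) {X} → Fm sg n X → Tm sg [] (T X) → Set

  RealT s ρ A r =
    (Σ (Tm sg [] _) λ r' → (app r s ⇝' inl sg r') × Real s ρ A r')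
    ⊎ (Σ (Tm sg [] Ex) λ e → (app r s ⇝' inr sg e) × (e properlyExtends s))

  Real s ρ (at a)   r = (r ⇝' con unitc) × TrueA sg S ρ a
  Real s ρ (A ∧' B) r = Real s ρ A (π1 sg r) × Real s ρ B (π2 sg r)
  Real s ρ (A ∨' B) r =
    (Σ (Tm sg [] _) λ a → (r ⇝' inl sg a) × Real s ρ A a)
    ⊎ (Σ (Tm sg [] _) λ b → (r ⇝' inr sg b) × Real s ρ B b)
  Real s ρ (A ⟹ B)  r = ∀ p → Real s ρ A p → RealT s ρ B (app r p)
  Real s ρ (fall A) r = ∀ m → RealT s (_▸_ sg ρ (num sg m)) A (app r (num sg m))
  Real s ρ (fex A)  r = Real s (_▸_ sg ρ (π1 sg r)) A (π2 sg r)

  data RealHyps (s : Tm sg [] State) {n} (ns : Vec ℕ n) : Hyps sg n → Set where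
    []  : RealHyps s ns []
    _∷_ : ∀ {X} {A : Fm sg n X} {Γ} {p : Tm sg [] X} →
          Real s (numEnv sg S ns) A p → RealHyps s ns Γ → RealHyps s ns ((X , A) ∷ Γ)

  closeSub : ∀ {s n} {ns : Vec ℕ n} {Γ : Hyps sg n} → RealHyps s ns Γ → Sub sg (ctxOf sg Γ) []
  closeSub {ns = ns} []              x         = numEnv sg S ns x
  closeSub (_∷_ {p = p} _ ps) here      = p
  closeSub (_∷_ {p = p} _ ps) (there x) = closeSub ps x

  Valid : ∀ {n} {Γ : Hyps sg n} {X} {A : Fm sg n X} →
          Der sg S Γ A → Tm sg [] State → Set
  Valid {n} {Γ} {A = A} D s = (ns : Vec ℕ n) (ps : RealHyps s ns Γ) →
    RealT s (numEnv sg S ns) A (sub sg (closeSub ps) (dec sg S D))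

-- The monad
-- combinators are characterised once: run at the state s, star^k f m₁ … m_k either
-- reaches f a₁ … a_k with every aᵢ satisfying what mᵢ T-realizes, or throws a
-- proper extension of s; (EX) covers merge when both arguments throw.  EM is
-- realized by asking query_P: a counterexample it returns is genuine by (IR1), and
-- otherwise each instance is either confirmed by eval_P (IR2) or refuted by a proper
-- extension of s (IR3).  Induction is realized by the bounded recursor, whose
-- unfoldings are handled by course-of-values induction on the argument.  Since
-- ∃-realizers carry their witness as the unevaluated term π₁ r, realizability is
-- shown invariant under replacing arithmetic terms in the environment by
-- convertible ones.

module Submission where

open import Defs
open import Data.Nat using (ℕ)
open import Data.List using ([])

open import Data.Nat using (zero; suc; _<_)
open import Data.Nat.Induction using (<-rec)
open import Data.List using (List; _∷_; length)
open import Data.List.Relation.Unary.All using (All; []; _∷_)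
open import Data.Vec as V using (Vec; []; _∷_; _∷ʳ_; replicate)
import Data.Vec.Properties as VP
open import Data.Vec.Relation.Binary.Pointwise.Inductive using (Pointwise; []; _∷_)
open import Data.Product using (Σ; _×_; _,_; proj₁; proj₂)
open import Data.Product.Function.NonDependent.Propositional using (_×-⇔_)
open import Data.Sum using (_⊎_; inj₁; inj₂)
open import Data.Empty using (⊥-elim)
open import Data.Unit using (⊤; tt)
open import Function using (id)
open import Function.Bundles using (_⇔_; mk⇔; Equivalence)
open import Relation.Binary.PropositionalEquality
open import Relation.Binary.Construct.Closure.ReflexiveTransitive using (ε; _◅_; _◅◅_; gmap)

open Equivalence using (to; from)

map-map : ∀ {a b c} {A : Set a} {B : Set b} {C : Set c} {f : B → C} {g : A → B} {h : A → C} →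
          (∀ x → f (g x) ≡ h x) → ∀ {k} (xs : Vec A k) → V.map f (V.map g xs) ≡ V.map h xs
map-map {f = f} {g} e xs = trans (sym (VP.map-∘ f g xs)) (VP.map-cong e xs)

module _ {a b r} {A : Set a} {B : Set b} {R : A → B → Set r} where

  Pointwise-∷ʳ : ∀ {k} {xs : Vec A k} {ys : Vec B k} {x y} →
                 Pointwise R xs ys → R x y → Pointwise R (xs ∷ʳ x) (ys ∷ʳ y)
  Pointwise-∷ʳ []         r = r ∷ []
  Pointwise-∷ʳ (r' ∷ rs) r = r' ∷ Pointwise-∷ʳ rs r

module Substitution (sg : Sig) where

  infixl 5 _▹_
  _▹_ : ∀ {Γ Δ A} → Sub sg Γ Δ → Tm sg Δ A → Sub sg (A ∷ Γ) Δ
  _▹_ = _▸_ sg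

  sub-cong : ∀ {Γ Δ A} {σ σ' : Sub sg Γ Δ} → (∀ {B} (x : Γ ∋ B) → σ x ≡ σ' x) →
             (t : Tm sg Γ A) → sub sg σ t ≡ sub sg σ' t
  sub-cong h (var x)   = h x
  sub-cong h (lam t)   = cong lam (sub-cong (λ { here → refl ; (there x) → cong (wk sg) (h x) }) t)
  sub-cong h (app t u) = cong₂ app (sub-cong h t) (sub-cong h u)
  sub-cong h (con c)   = refl

  ren-ren : ∀ {Γ Δ Θ A} {ρ : Ren sg Δ Θ} {ρ' : Ren sg Γ Δ} {ρ'' : Ren sg Γ Θ} →
            (∀ {B} (x : Γ ∋ B) → ρ (ρ' x) ≡ ρ'' x) →
            (t : Tm sg Γ A) → ren sg ρ (ren sg ρ' t) ≡ ren sg ρ'' t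
  ren-ren h (var x)   = cong var (h x)
  ren-ren h (lam t)   = cong lam (ren-ren (λ { here → refl ; (there x) → cong there (h x) }) t)
  ren-ren h (app t u) = cong₂ app (ren-ren h t) (ren-ren h u)
  ren-ren h (con c)   = refl

  sub-ren : ∀ {Γ Δ Θ A} {σ : Sub sg Δ Θ} {ρ : Ren sg Γ Δ} {τ : Sub sg Γ Θ} →
            (∀ {B} (x : Γ ∋ B) → σ (ρ x) ≡ τ x) →
            (t : Tm sg Γ A) → sub sg σ (ren sg ρ t) ≡ sub sg τ t
  sub-ren h (var x)   = h x
  sub-ren h (lam t)   = cong lam (sub-ren (λ { here → refl ; (there x) → cong (wk sg) (h x) }) t)
  sub-ren h (app t u) = cong₂ app (sub-ren h t) (sub-ren h u)
  sub-ren h (con c)   = refl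

  ren-sub : ∀ {Γ Δ Θ A} {ρ : Ren sg Δ Θ} {σ : Sub sg Γ Δ} {τ : Sub sg Γ Θ} →
            (∀ {B} (x : Γ ∋ B) → ren sg ρ (σ x) ≡ τ x) →
            (t : Tm sg Γ A) → ren sg ρ (sub sg σ t) ≡ sub sg τ t
  ren-sub h (var x)   = h x
  ren-sub {ρ = ρ} {σ} h (lam t) = cong lam (ren-sub h' t)
    where
      h' : ∀ {B} (x : _ ∋ B) → ren sg (ext sg ρ) (exts sg σ x) ≡ exts sg _ x
      h' here      = refl
      h' (there x) = trans (ren-ren (λ _ → refl) (σ x))
                           (trans (sym (ren-ren (λ _ → refl) (σ x))) (cong (wk sg) (h x)))
  ren-sub h (app t u) = cong₂ app (ren-sub h t) (ren-sub h u)
  ren-sub h (con c)   = refl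

  sub-sub : ∀ {Γ Δ Θ A} {τ : Sub sg Δ Θ} {σ : Sub sg Γ Δ} {υ : Sub sg Γ Θ} →
            (∀ {B} (x : Γ ∋ B) → sub sg τ (σ x) ≡ υ x) →
            (t : Tm sg Γ A) → sub sg τ (sub sg σ t) ≡ sub sg υ t
  sub-sub h (var x)   = h x
  sub-sub {τ = τ} {σ} h (lam t) = cong lam (sub-sub h' t)
    where
      h' : ∀ {B} (x : _ ∋ B) → sub sg (exts sg τ) (exts sg σ x) ≡ exts sg _ x
      h' here      = refl
      h' (there x) = trans (sub-ren (λ _ → refl) (σ x))
                           (trans (sym (ren-sub (λ _ → refl) (σ x))) (cong (wk sg) (h x)))
  sub-sub h (app t u) = cong₂ app (sub-sub h t) (sub-sub h u)
  sub-sub h (con c)   = refl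

  sub-id : ∀ {Γ A} {σ : Sub sg Γ Γ} → (∀ {B} (x : Γ ∋ B) → σ x ≡ var x) →
           (t : Tm sg Γ A) → sub sg σ t ≡ t
  sub-id h (var x)   = h x
  sub-id h (lam t)   = cong lam (sub-id (λ { here → refl ; (there x) → cong (wk sg) (h x) }) t)
  sub-id h (app t u) = cong₂ app (sub-id h t) (sub-id h u)
  sub-id h (con c)   = refl

  sub-▹-wk : ∀ {Γ Δ A B} (σ : Sub sg Γ Δ) (u : Tm sg Δ B) (t : Tm sg Γ A) →
             sub sg (σ ▹ u) (wk sg t) ≡ sub sg σ t
  sub-▹-wk σ u = sub-ren (λ _ → refl)

  wk-[] : ∀ {Γ A B} (u : Tm sg Γ B) (t : Tm sg Γ A) → _[_] sg (wk sg t) u ≡ t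
  wk-[] u t = trans (sub-▹-wk var u t) (sub-id (λ _ → refl) t)

  sub-exts-wk : ∀ {Γ Δ A B} (σ : Sub sg Γ Δ) (t : Tm sg Γ A) →
                sub sg (exts sg {B = B} σ) (wk sg t) ≡ wk sg (sub sg σ t)
  sub-exts-wk σ t = trans (sub-ren (λ _ → refl) t) (sym (ren-sub (λ _ → refl) t))

  sub-exts-[] : ∀ {Γ Δ A B} (σ : Sub sg Γ Δ) (b : Tm sg (A ∷ Γ) B) (u : Tm sg Δ A) →
                _[_] sg (sub sg (exts sg σ) b) u ≡ sub sg (σ ▹ u) b
  sub-exts-[] σ b u = sub-sub (λ { here → refl ; (there x) → wk-[] u (σ x) }) b

  sub-closed : ∀ {Γ A} (σ : Sub sg Γ []) (t : Tm sg [] A) → sub sg σ (ren sg (λ ()) t) ≡ t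
  sub-closed σ t = trans (sub-ren {τ = var} (λ ()) t) (sub-id (λ ()) t)

  lamBody : ∀ {Γ A B} → Tm sg Γ (A ⇒ B) → Tm sg (A ∷ Γ) B
  lamBody (lam t) = t
  lamBody t       = app (wk sg t) (v0 sg)

  sub-starK : ∀ {Γ Δ k} (σ : Sub sg Γ Δ) (Xs : Vec Ty k) (Y : Ty) →
              sub sg σ (starK sg {Γ} Xs Y) ≡ starK sg {Δ} Xs Y
  sub-starK σ []            Y = refl
  sub-starK σ (X ∷ [])      Y = refl
  sub-starK σ (X ∷ X' ∷ Xs) Y =
    cong (λ z → lam (lam (lam (app (app z (lam (app (app (v3 sg) (π1 sg (v0 sg))) (π2 sg (v0 sg)))))
                                   (app (app (mergeM sg) (v1 sg)) (v0 sg))))))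
         (sub-starK (exts sg (exts sg (exts sg σ))) ((X ⊗ X') ∷ Xs) Y)

  sub-liftUnit : ∀ {Γ Δ k} (σ : Sub sg Γ Δ) (Xs : Vec Ty k) {Y : Ty} (t : Tm sg Γ (Xs ⇛ Y)) →
                 sub sg σ (liftUnit sg Xs t) ≡ liftUnit sg Xs (sub sg σ t)
  sub-liftUnit σ []       t = refl
  sub-liftUnit σ (X ∷ Xs) t =
    cong lam (trans (sub-liftUnit (exts sg σ) Xs (app (wk sg t) (v0 sg)))
                    (cong (λ w → liftUnit sg Xs (app w (v0 sg))) (sub-exts-wk σ t)))

  sub-raiseK : ∀ {Γ Δ k} (σ : Sub sg Γ Δ) (Xs : Vec Ty k) (Y : Ty) →
               sub sg σ (raiseK sg {Γ} Xs Y) ≡ raiseK sg {Δ} Xs Y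
  sub-raiseK σ Xs Y = cong lam (cong₂ app (sub-starK (exts sg σ) Xs Y) (sub-liftUnit (exts sg σ) Xs (v0 sg)))

  sub-appsN : ∀ {Γ Δ k B} (σ : Sub sg Γ Δ) (f : Tm sg Γ (NatsArr k B)) (us : Vec (Tm sg Γ Nat) k) →
              sub sg σ (appsN sg f us) ≡ appsN sg (sub sg σ f) (V.map (sub sg σ) us)
  sub-appsN σ f []       = refl
  sub-appsN σ f (u ∷ us) = sub-appsN σ (app f u) us

module Reduction (sg : Sig) (S : Sys sg) where
  open Substitution sg

  infix 3 _↦_ _↠_
  _↦_ : ∀ {Γ A} → Tm sg Γ A → Tm sg Γ A → Set
  _↦_ = _⟶_ sg S
  _↠_ : ∀ {Γ A} → Tm sg Γ A → Tm sg Γ A → Set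
  _↠_ = _⇝_ sg S

  ≡⇒↠ : ∀ {Γ A} {a b : Tm sg Γ A} → a ≡ b → a ↠ b
  ≡⇒↠ refl = ε

  one : ∀ {Γ A} {a b : Tm sg Γ A} → a ↦ b → a ↠ b
  one r = r ◅ ε

  step≡ : ∀ {Γ A} {a b c : Tm sg Γ A} → a ↦ b → b ≡ c → a ↠ c
  step≡ r refl = one r

  ↠-appˡ : ∀ {Γ A B} {t t' : Tm sg Γ (A ⇒ B)} {u} → t ↠ t' → app t u ↠ app t' u
  ↠-appˡ = gmap _ ξl

  ↠-appʳ : ∀ {Γ A B} {t : Tm sg Γ (A ⇒ B)} {u u'} → u ↠ u' → app t u ↠ app t u'
  ↠-appʳ = gmap _ ξr

  ↠-case : ∀ {Γ X Y Z} {t t' : Tm sg Γ (X ⊕ Y)} {f : Tm sg Γ (X ⇒ Z)} {g} →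
           t ↠ t' → case sg t f g ↠ case sg t' f g
  ↠-case r = ↠-appˡ (↠-appˡ (↠-appʳ r))

  β-sub : ∀ {Γ A B} (σ : Sub sg Γ []) (b : Tm sg (A ∷ Γ) B) (u : Tm sg [] A) →
          app (sub sg σ (lam b)) u ↠ sub sg (σ ▹ u) b
  β-sub σ b u = step≡ β (sub-exts-[] σ b u)

module Conversion (sg : Sig) (S : Sys sg) (H : Assumptions sg S) where
  open Substitution sg
  open Reduction sg S
  open Assumptions H

  infix 4 _≈_ _~_
  _≈_ : Tm sg [] Nat → Tm sg [] Nat → Set
  a ≈ b = Σ ℕ λ k → (a ↠ num sg k) × (b ↠ num sg k)

  ≈-refl : ∀ a → a ≈ a
  ≈-refl a = let k , r = NUM a in k , r , r

  ≈-sym : ∀ {a b} → a ≈ b → b ≈ a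
  ≈-sym (k , ra , rb) = k , rb , ra

  ≈-trans : ∀ {a b c} → a ≈ b → b ≈ c → a ≈ c
  ≈-trans (k , ra , rb) (k' , rb' , rc) with UNIQ rb rb'
  ... | refl = k , ra , rc

  ≡⇒≈ : ∀ {a b} → a ≡ b → a ≈ b
  ≡⇒≈ {a} refl = ≈-refl a

  ↠-joins : ∀ {w a b} → w ↠ a → w ↠ b → a ≈ b
  ↠-joins {a = a} {b} ra rb with NUM a | NUM b
  ... | k , ra' | k' , rb' with UNIQ (ra ◅◅ ra') (rb ◅◅ rb')
  ... | refl = k , ra' , rb'

  ↠⇒≈ : ∀ {a b} → a ↠ b → a ≈ b
  ↠⇒≈ = ↠-joins ε

  ≈-num : ∀ {a b m} → a ≈ b → a ↠ num sg m → b ↠ num sg m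
  ≈-num (k , ra , rb) r with UNIQ ra r
  ... | refl = rb

  -- Reductions cannot be pushed under binders (δ need not be stable under
  -- renaming), so each variable is instead abstracted and instantiated by β.
  sub-↠-≈ : ∀ n (σ τ : Sub sg (Nats n) []) → ((x : Nats n ∋ Nat) → σ x ↠ τ x) →
            (t : ArTm sg n) → sub sg σ t ≈ sub sg τ t
  sub-↠-≈ zero    σ τ h t = ≡⇒≈ (sub-cong (λ ()) t)
  sub-↠-≈ (suc n) σ τ h t =
    ≈-trans (↠-joins (step≡ β (trans (sub-exts-[] σ₀ t a) (σ-split σ t)))
                     (↠-appʳ (h here) ◅◅ β-sub σ₀ t b))
      (≈-trans (subst₂ _≈_ (close-b σ₀) (close-b τ₀)
                       (sub-↠-≈ n σ₀ τ₀ (λ x → h (there x)) (sub sg θ t)))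
               (≡⇒≈ (σ-split τ t)))
    where
      σ₀ τ₀ : Sub sg (Nats n) []
      σ₀ x = σ (there x)
      τ₀ x = τ (there x)
      a b : Tm sg [] Nat
      a = σ here
      b = τ here
      σ-split : (ρ : Sub sg (Nats (suc n)) []) (t : ArTm sg (suc n)) →
                sub sg ((λ x → ρ (there x)) ▹ ρ here) t ≡ sub sg ρ t
      σ-split ρ = sub-cong (λ { here → refl ; (there x) → refl })
      θ : Sub sg (Nats (suc n)) (Nats n)
      θ here      = ren sg (λ ()) b
      θ (there x) = var x
      close-b : (ρ : Sub sg (Nats n) []) → sub sg ρ (sub sg θ t) ≡ sub sg (ρ ▹ b) t
      close-b ρ = sub-sub (λ { here → sub-closed ρ b ; (there x) → refl }) t

  record _~_ {n} (ρ ρ' : Sub sg (Nats n) []) : Set where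
    constructor pointwise
    field lookup : (x : Nats n ∋ Nat) → ρ x ≈ ρ' x
  open _~_ public

  ~-refl : ∀ {n} (ρ : Sub sg (Nats n) []) → ρ ~ ρ
  ~-refl ρ = pointwise λ x → ≈-refl (ρ x)

  ~-sym : ∀ {n} {ρ ρ' : Sub sg (Nats n) []} → ρ ~ ρ' → ρ' ~ ρ
  ~-sym h = pointwise λ x → ≈-sym (lookup h x)

  ~-▹ : ∀ {n} {ρ ρ' : Sub sg (Nats n) []} {u u'} → ρ ~ ρ' → u ≈ u' → (ρ ▹ u) ~ (ρ' ▹ u')
  ~-▹ h e = pointwise λ { here → e ; (there x) → lookup h x }

  normalise : ∀ {n} → Sub sg (Nats n) [] → Sub sg (Nats n) []
  normalise {suc n} ρ here      = num sg (proj₁ (NUM (ρ here)))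
  normalise {suc n} ρ (there x) = normalise (λ y → ρ (there y)) x

  ↠-normalise : ∀ {n} {ρ ρ' : Sub sg (Nats n) []} → ρ ~ ρ' → (x : Nats n ∋ Nat) → ρ' x ↠ normalise ρ x
  ↠-normalise {suc n} {ρ} h here      = ≈-num (lookup h here) (proj₂ (NUM (ρ here)))
  ↠-normalise {suc n} {ρ} {ρ'} h (there x) =
    ↠-normalise {ρ = λ y → ρ (there y)} {λ y → ρ' (there y)} (pointwise λ y → lookup h (there y)) x

  sub-~ : ∀ {n} {ρ ρ' : Sub sg (Nats n) []} → ρ ~ ρ' → (t : ArTm sg n) → sub sg ρ t ≈ sub sg ρ' t
  sub-~ {n} {ρ} {ρ'} h t =
    ≈-trans (sub-↠-≈ n ρ (normalise ρ) (↠-normalise (~-refl ρ)) t)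
            (≈-sym (sub-↠-≈ n ρ' (normalise ρ) (↠-normalise h) t))

module Monad (sg : Sig) (S : Sys sg) (H : Assumptions sg S) (s : Tm sg [] State) where
  open Substitution sg
  open Reduction sg S
  open Assumptions H

  ThrowsExtension : ∀ {Y} → Tm sg [] (Y ⊕ Ex) → Set
  ThrowsExtension t = Σ (Tm sg [] Ex) λ e → (t ↠ inr sg e) × (e properlyExtends s)

  Proceeds : ∀ {A : Set} {Y} → (A → Set) → (A → Tm sg [] (Y ⊕ Ex)) → Tm sg [] (Y ⊕ Ex) → Set
  Proceeds Q k t = (Σ _ λ a → (t ↠ k a) × Q a) ⊎ ThrowsExtension t

  -- RealT s ρ A r unfolds to Outcome (Real s ρ A) (app r s).
  Outcome : ∀ {X} → (Tm sg [] X → Set) → Tm sg [] (X ⊕ Ex) → Set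
  Outcome Q = Proceeds Q (inl sg)

  RealizesT : ∀ {X} → (Tm sg [] X → Set) → Tm sg [] (T X) → Set
  RealizesT Q m = Outcome Q (app m s)

  Proceeds-backward : ∀ {A : Set} {Y} {Q : A → Set} {k} {t t' : Tm sg [] (Y ⊕ Ex)} →
                      t ↠ t' → Proceeds Q k t' → Proceeds Q k t
  Proceeds-backward r (inj₁ (a , r' , q)) = inj₁ (a , r ◅◅ r' , q)
  Proceeds-backward r (inj₂ (e , r' , x)) = inj₂ (e , r ◅◅ r' , x)

  Proceeds-bind : ∀ {A B : Set} {Y} {Q : A → Set} {P : B → Set} {k} {k' : B → Tm sg [] (Y ⊕ Ex)}
                    {t : Tm sg [] (Y ⊕ Ex)} →
                  Proceeds Q k t → (∀ a → Q a → Proceeds P k' (k a)) → Proceeds P k' t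
  Proceeds-bind (inj₁ (a , r , q)) f = Proceeds-backward r (f a q)
  Proceeds-bind (inj₂ x)           f = inj₂ x

  Outcome-inl : ∀ {X} {Q : Tm sg [] X → Set} {a} → Q a → Outcome Q (inl sg a)
  Outcome-inl q = inj₁ (_ , ε , q)

  Outcome-map : ∀ {X} {Q Q' : Tm sg [] X → Set} {t} → (∀ a → Q a → Q' a) → Outcome Q t → Outcome Q' t
  Outcome-map f o = Proceeds-bind o (λ a q → Outcome-inl (f a q))

  unitM-↠ : ∀ {X} (x : Tm sg [] X) → app (app (unitM sg) x) s ↠ inl sg x
  unitM-↠ x = ↠-appˡ (one β) ◅◅ step≡ β (cong (inl sg) (wk-[] s x))

  raise⁰-↠ : ∀ {Y} (g : Tm sg [] Y) → app (app (raiseK sg [] Y) g) s ↠ inl sg g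
  raise⁰-↠ g = ↠-appˡ (one β ◅◅ one β) ◅◅ unitM-↠ g

  starM-unfold : ∀ {X Y} (f : Tm sg [] (X ⇒ T Y)) (m : Tm sg [] (T X)) →
                 app (app (app (starM sg) f) m) s ↠
                 case sg (app m s) (lam (app (app (wk sg f) (v0 sg)) (wk sg s))) (con inrc)
  starM-unfold f m = ↠-appˡ (↠-appˡ (one β)) ◅◅ ↠-appˡ (β-sub (var ▹ f) (lamBody (lamBody (starM sg))) m)
                     ◅◅ β-sub ((var ▹ f) ▹ m) (lamBody (lamBody (lamBody (starM sg)))) s

  starM-spec : ∀ {X Y} {Q : Tm sg [] X → Set} (f : Tm sg [] (X ⇒ T Y)) (m : Tm sg [] (T X)) →
               RealizesT Q m → Proceeds Q (λ a → app (app f a) s) (app (app (app (starM sg) f) m) s)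
  starM-spec f m (inj₁ (a , r , q)) =
    inj₁ (a , starM-unfold f m ◅◅ ↠-case r ◅◅ caseL ◅
              step≡ β (cong₂ (λ x y → app (app x a) y) (wk-[] a f) (wk-[] a s)) , q)
  starM-spec f m (inj₂ (e , r , x)) = inj₂ (e , starM-unfold f m ◅◅ ↠-case r ◅◅ one caseR , x)

  Paired : ∀ {X Y} → (Tm sg [] X → Set) → (Tm sg [] Y → Set) → Tm sg [] (X ⊗ Y) → Set
  Paired Q₁ Q₂ z = Σ _ λ a₁ → Σ _ λ a₂ → (z ≡ pair sg a₁ a₂) × Q₁ a₁ × Q₂ a₂

  module _ {X Y} (m₁ : Tm sg [] (T X)) (m₂ : Tm sg [] (T Y)) where

    mergeM-unfold : app (app (app (mergeM sg) m₁) m₂) s ↠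
                    sub sg (((var ▹ m₁) ▹ m₂) ▹ s) (lamBody (lamBody (lamBody (mergeM sg))))
    mergeM-unfold =
      ↠-appˡ (↠-appˡ (one β)) ◅◅ ↠-appˡ (β-sub (var ▹ m₁) (lamBody (lamBody (mergeM sg))) m₂)
      ◅◅ β-sub ((var ▹ m₁) ▹ m₂) (lamBody (lamBody (lamBody (mergeM sg)))) s

    mergeM-inl : ∀ {a} → app m₁ s ↠ inl sg a → app (app (app (mergeM sg) m₁) m₂) s ↠
                 case sg (app m₂ s) (lam (inl sg (pair sg (wk sg a) (v0 sg)))) (con inrc)
    mergeM-inl {a} r =
      mergeM-unfold ◅◅ ↠-case r ◅◅ caseL ◅
      step≡ β (cong₂ (λ x y → case sg (app x y) (lam (inl sg (pair sg (wk sg a) (v0 sg)))) (con inrc))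
                     (wk-[] a m₂) (wk-[] a s))

    mergeM-inr : ∀ {e} → app m₁ s ↠ inr sg e → app (app (app (mergeM sg) m₁) m₂) s ↠
                 case sg (app m₂ s) (lam (inr sg (wk sg e)))
                                    (lam (inr sg (app (app (con mergeExc) (wk sg e)) (v0 sg))))
    mergeM-inr {e} r =
      mergeM-unfold ◅◅ ↠-case r ◅◅ caseR ◅
      step≡ β (cong₂ (λ x y → case sg (app x y) (lam (inr sg (wk sg e)))
                                       (lam (inr sg (app (app (con mergeExc) (wk sg e)) (v0 sg)))))
                     (wk-[] e m₂) (wk-[] e s))

    mergeM-spec : ∀ {Q₁ : Tm sg [] X → Set} {Q₂ : Tm sg [] Y → Set} →
                  RealizesT Q₁ m₁ → RealizesT Q₂ m₂ →
                  RealizesT (Paired Q₁ Q₂) (app (app (mergeM sg) m₁) m₂)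
    mergeM-spec (inj₁ (a , ra , qa)) (inj₁ (b , rb , qb)) =
      inj₁ (pair sg a b , mergeM-inl ra ◅◅ ↠-case rb ◅◅ caseL ◅
                          step≡ β (cong (λ x → inl sg (pair sg x b)) (wk-[] b a)) ,
            (a , b , refl , qa , qb))
    mergeM-spec (inj₁ (a , ra , _)) (inj₂ (e , rb , pe)) =
      inj₂ (e , mergeM-inl ra ◅◅ ↠-case rb ◅◅ one caseR , pe)
    mergeM-spec (inj₂ (e , ra , pe)) (inj₁ (b , rb , _)) =
      inj₂ (e , mergeM-inr ra ◅◅ ↠-case rb ◅◅ caseL ◅ step≡ β (cong (inr sg) (wk-[] b e)) , pe)
    mergeM-spec (inj₂ (e , ra , pe)) (inj₂ (e' , rb , pe')) =
      inj₂ (app (app (con mergeExc) e) e' ,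
            mergeM-inr ra ◅◅ ↠-case rb ◅◅ caseR ◅
            step≡ β (cong (λ x → inr sg (app (app (con mergeExc) x) e')) (wk-[] e' e)) ,
            EX pe pe')

  data Args : ∀ {k} → Vec Ty k → Set where
    []  : Args []
    _∷_ : ∀ {k X} {Xs : Vec Ty k} → Tm sg [] X → Args Xs → Args (X ∷ Xs)

  appArgs : ∀ {k} {Xs : Vec Ty k} {B} → Tm sg [] (Xs ⇛ B) → Args Xs → Tm sg [] B
  appArgs f []       = f
  appArgs f (a ∷ as) = appArgs (app f a) as

  ↠-appArgs : ∀ {k} {Xs : Vec Ty k} {B} {t t' : Tm sg [] (Xs ⇛ B)} (as : Args Xs) →
              t ↠ t' → appArgs t as ↠ appArgs t' as
  ↠-appArgs []       r = r
  ↠-appArgs (a ∷ as) r = ↠-appArgs as (↠-appˡ r)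

  ↠-run : ∀ {k} {Xs : Vec Ty k} {B} {t t' : Tm sg [] (Xs ⇛ T B)} (as : Args Xs) →
          t ↠ t' → app (appArgs t as) s ↠ app (appArgs t' as) s
  ↠-run as r = ↠-appˡ (↠-appArgs as r)

  data Preds : ∀ {k} → Vec Ty k → Set₁ where
    []  : Preds []
    _∷_ : ∀ {k X} {Xs : Vec Ty k} → (Tm sg [] X → Set) → Preds Xs → Preds (X ∷ Xs)

  Holds : ∀ {k} {Xs : Vec Ty k} → Preds Xs → Args Xs → Set
  Holds []       []       = ⊤
  Holds (Q ∷ Qs) (a ∷ as) = Q a × Holds Qs as

  HoldsT : ∀ {k} {Xs : Vec Ty k} → Preds Xs → Args (mapT Xs) → Set
  HoldsT []       []       = ⊤
  HoldsT (Q ∷ Qs) (m ∷ ms) = RealizesT Q m × HoldsT Qs ms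

  uncurried : ∀ {X X' B} → Tm sg [] (X ⇒ X' ⇒ B) → Tm sg [] (X ⊗ X' ⇒ B)
  uncurried f = lam (app (app (wk sg f) (π1 sg (v0 sg))) (π2 sg (v0 sg)))

  uncurried-pair : ∀ {X X' B} (f : Tm sg [] (X ⇒ X' ⇒ B)) a₁ a₂ →
                   app (uncurried f) (pair sg a₁ a₂) ↠ app (app f a₁) a₂
  uncurried-pair f a₁ a₂ =
    step≡ β (cong (λ w → app (app w (π1 sg (pair sg a₁ a₂))) (π2 sg (pair sg a₁ a₂))) (wk-[] _ f))
    ◅◅ ↠-appˡ (↠-appʳ (one π₁β)) ◅◅ ↠-appʳ (one π₂β)

  starK-unfold : ∀ {k X X'} (Xs : Vec Ty k) (Y : Ty) (f : Tm sg [] ((X ∷ X' ∷ Xs) ⇛ T Y)) m₁ m₂ →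
                 app (app (app (starK sg (X ∷ X' ∷ Xs) Y) f) m₁) m₂ ↠
                 app (app (starK sg ((X ⊗ X') ∷ Xs) Y) (uncurried f)) (app (app (mergeM sg) m₁) m₂)
  starK-unfold {X = X} {X'} Xs Y f m₁ m₂ =
    ↠-appˡ (↠-appˡ (one β))
    ◅◅ ↠-appˡ (β-sub (var ▹ f) (lamBody (lamBody (starK sg (X ∷ X' ∷ Xs) Y))) m₁)
    ◅◅ β-sub ((var ▹ f) ▹ m₁) (lamBody (lamBody (lamBody (starK sg (X ∷ X' ∷ Xs) Y)))) m₂
    ◅◅ ≡⇒↠ (cong (λ w → app (app w (uncurried f)) (app (app (mergeM sg) m₁) m₂))
                 (sub-starK (((var ▹ f) ▹ m₁) ▹ m₂) ((X ⊗ X') ∷ Xs) Y))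

  starK-spec : ∀ {k} (Xs : Vec Ty k) (Y : Ty) (Qs : Preds Xs) (f : Tm sg [] (Xs ⇛ T Y))
               (ms : Args (mapT Xs)) → HoldsT Qs ms →
               Proceeds (Holds Qs) (λ as → app (appArgs f as) s) (app (appArgs (app (starK sg Xs Y) f) ms) s)
  starK-spec [] Y [] f [] tt = inj₁ ([] , ↠-appˡ (one β) , tt)
  starK-spec (X ∷ []) Y (Q ∷ []) f (m ∷ []) (rm , tt) =
    Proceeds-bind (starM-spec f m rm) λ a q → inj₁ (a ∷ [] , ε , q , tt)
  starK-spec (X ∷ X' ∷ Xs) Y (Q₁ ∷ Q₂ ∷ Qs) f (m₁ ∷ m₂ ∷ ms) (r₁ , r₂ , rs) =
    Proceeds-backward (↠-run ms (starK-unfold Xs Y f m₁ m₂))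
      (Proceeds-bind (starK-spec ((X ⊗ X') ∷ Xs) Y (Paired Q₁ Q₂ ∷ Qs) (uncurried f)
                                 (app (app (mergeM sg) m₁) m₂ ∷ ms) (mergeM-spec m₁ m₂ r₁ r₂ , rs))
        λ { (_ ∷ as) ((a₁ , a₂ , refl , q₁ , q₂) , qs) →
              inj₁ (a₁ ∷ a₂ ∷ as , ↠-run as (uncurried-pair f a₁ a₂) , q₁ , q₂ , qs) })

  liftUnit-↠ : ∀ {k} (Xs : Vec Ty k) {Y} (g : Tm sg [] (Xs ⇛ Y)) (as : Args Xs) →
               appArgs (liftUnit sg Xs g) as ↠ app (unitM sg) (appArgs g as)
  liftUnit-↠ []       g []       = ε
  liftUnit-↠ (X ∷ Xs) g (a ∷ as) =
    ↠-appArgs as (step≡ β (trans (sub-liftUnit (var ▹ a) Xs (app (wk sg g) (v0 sg)))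
                                 (cong (λ w → liftUnit sg Xs (app w a)) (wk-[] a g))))
    ◅◅ liftUnit-↠ Xs (app g a) as

  raiseK-spec : ∀ {k} (Xs : Vec Ty k) (Y : Ty) (Qs : Preds Xs) (g : Tm sg [] (Xs ⇛ Y))
                (ms : Args (mapT Xs)) → HoldsT Qs ms →
                Proceeds (Holds Qs) (λ as → inl sg (appArgs g as)) (app (appArgs (app (raiseK sg Xs Y) g) ms) s)
  raiseK-spec Xs Y Qs g ms ok =
    Proceeds-backward
      (↠-run ms (step≡ β (cong₂ app (sub-starK (var ▹ g) Xs Y) (sub-liftUnit (var ▹ g) Xs (v0 sg)))))
      (Proceeds-bind (starK-spec Xs Y Qs (liftUnit sg Xs g) ms ok)
        λ as q → inj₁ (as , ↠-appˡ (liftUnit-↠ Xs g as) ◅◅ unitM-↠ (appArgs g as) , q))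

module Realizability (sg : Sig) (S : Sys sg) (H : Assumptions sg S) (s : Tm sg [] State) where
  open Substitution sg
  open Reduction sg S
  open Conversion sg S H
  open Monad sg S H s
  open Assumptions H

  Realizes : ∀ {n} → Sub sg (Nats n) [] → ∀ {X} → Fm sg n X → Tm sg [] X → Set
  Realizes = Real sg S H s

  Evaluates : Tm sg [] Nat → ℕ → Set
  Evaluates t m = t ↠ num sg m

  Outcome-⇔ : ∀ {X} {Q Q' : Tm sg [] X → Set} {t} → (∀ a → Q a ⇔ Q' a) → Outcome Q t ⇔ Outcome Q' t
  Outcome-⇔ e = mk⇔ (Outcome-map (λ a → to (e a))) (Outcome-map (λ a → from (e a)))

  Evaluates-~ : ∀ {n j} {ρ ρ' : Sub sg (Nats n) []} → ρ ~ ρ' → (ts : Vec (ArTm sg n) j) {ms : Vec ℕ j} →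
                Pointwise Evaluates (V.map (sub sg ρ) ts) ms → Pointwise Evaluates (V.map (sub sg ρ') ts) ms
  Evaluates-~ h []       []       = []
  Evaluates-~ h (t ∷ ts) (r ∷ rs) = ≈-num (sub-~ h t) r ∷ Evaluates-~ h ts rs

  Real-~ : ∀ {n} {ρ ρ' : Sub sg (Nats n) []} → ρ ~ ρ' →
           ∀ {X} (A : Fm sg n X) r → Realizes ρ A r → Realizes ρ' A r
  Real-~ h (at ⊥a)        r (_ , ())
  Real-~ h (at (pr P ts)) r (red , ms , pw , p) = red , ms , Evaluates-~ h ts pw , p
  Real-~ h (A ∧' B) r (a , b) = Real-~ h A _ a , Real-~ h B _ b
  Real-~ h (A ∨' B) r (inj₁ (a , red , x)) = inj₁ (a , red , Real-~ h A a x)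
  Real-~ h (A ∨' B) r (inj₂ (b , red , x)) = inj₂ (b , red , Real-~ h B b x)
  Real-~ h (A ⟹ B)  r f p x = Outcome-map (Real-~ h B) (f p (Real-~ (~-sym h) A p x))
  Real-~ h (fall A) r f m   = Outcome-map (Real-~ (~-▹ h (≈-refl (num sg m))) A) (f m)
  Real-~ h (fex A)  r x     = Real-~ (~-▹ h (≈-refl (π1 sg r))) A _ x

  Real-backward : ∀ {n} {ρ : Sub sg (Nats n) []} {X} (A : Fm sg n X) {r r'} →
                  r ↠ r' → Realizes ρ A r' → Realizes ρ A r
  Real-backward (at a)   red (red' , x) = red ◅◅ red' , x
  Real-backward (A ∧' B) red (a , b)    = Real-backward A (↠-appʳ red) a , Real-backward B (↠-appʳ red) b
  Real-backward (A ∨' B) red (inj₁ (a , red' , x)) = inj₁ (a , red ◅◅ red' , x)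
  Real-backward (A ∨' B) red (inj₂ (b , red' , x)) = inj₂ (b , red ◅◅ red' , x)
  Real-backward (A ⟹ B)  red f p x = Proceeds-backward (↠-appˡ (↠-appˡ red)) (f p x)
  Real-backward (fall A) red f m   = Proceeds-backward (↠-appˡ (↠-appˡ red)) (f m)
  Real-backward {ρ = ρ} (fex A) red x =
    Real-~ (~-▹ (~-refl ρ) (≈-sym (↠⇒≈ (↠-appʳ red)))) A _ (Real-backward A (↠-appʳ red) x)

  Real-fex-intro : ∀ {n} {ρ : Sub sg (Nats n) []} {X} (A : Fm sg (suc n) X) {r u a} →
                   r ↠ pair sg u a → Realizes (ρ ▹ u) A a → Realizes ρ (fex A) r
  Real-fex-intro {ρ = ρ} A red q =
    Real-backward (fex A) red
      (Real-~ (~-▹ (~-refl ρ) (≈-sym (↠⇒≈ (one π₁β)))) A _ (Real-backward A (one π₂β) q))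

  Real-subF : ∀ {n m X} (σ : Sub sg (Nats n) (Nats m)) (ρ : Sub sg (Nats m) []) (ρ' : Sub sg (Nats n) []) →
              (∀ {B} (x : Nats n ∋ B) → sub sg ρ (σ x) ≡ ρ' x) → (A : Fm sg n X) (r : Tm sg [] X) →
              Realizes ρ (subF sg σ A) r ⇔ Realizes ρ' A r
  Real-subF σ ρ ρ' h (at ⊥a)        r = mk⇔ id id
  Real-subF σ ρ ρ' h (at (pr P ts)) r =
    mk⇔ (λ (red , ms , pw , p) → red , ms , subst (λ v → Pointwise Evaluates v ms) args pw , p)
        (λ (red , ms , pw , p) → red , ms , subst (λ v → Pointwise Evaluates v ms) (sym args) pw , p)
    where args = map-map (sub-sub h) ts
  Real-subF σ ρ ρ' h (A ∧' B) r = Real-subF σ ρ ρ' h A (π1 sg r) ×-⇔ Real-subF σ ρ ρ' h B (π2 sg r)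
  Real-subF σ ρ ρ' h (A ∨' B) r =
    mk⇔ (λ { (inj₁ (a , red , x)) → inj₁ (a , red , to (Real-subF σ ρ ρ' h A a) x)
           ; (inj₂ (b , red , x)) → inj₂ (b , red , to (Real-subF σ ρ ρ' h B b) x) })
        (λ { (inj₁ (a , red , x)) → inj₁ (a , red , from (Real-subF σ ρ ρ' h A a) x)
           ; (inj₂ (b , red , x)) → inj₂ (b , red , from (Real-subF σ ρ ρ' h B b) x) })
  Real-subF σ ρ ρ' h (A ⟹ B) r =
    mk⇔ (λ f p x → to   (Outcome-⇔ (Real-subF σ ρ ρ' h B)) (f p (from (Real-subF σ ρ ρ' h A p) x)))
        (λ f p x → from (Outcome-⇔ (Real-subF σ ρ ρ' h B)) (f p (to   (Real-subF σ ρ ρ' h A p) x)))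
  Real-subF σ ρ ρ' h (fall A) r =
    mk⇔ (λ f m → to   (Outcome-⇔ (Real-subF (exts sg σ) _ _ (exts-h (num sg m)) A)) (f m))
        (λ f m → from (Outcome-⇔ (Real-subF (exts sg σ) _ _ (exts-h (num sg m)) A)) (f m))
    where
      exts-h : ∀ u {B} (x : Nats (suc _) ∋ B) → sub sg (ρ ▹ u) (exts sg σ x) ≡ (ρ' ▹ u) x
      exts-h u here      = refl
      exts-h u (there x) = trans (sub-▹-wk ρ u (σ x)) (h x)
  Real-subF σ ρ ρ' h (fex A) r = Real-subF (exts sg σ) (ρ ▹ π1 sg r) (ρ' ▹ π1 sg r) exts-h A (π2 sg r)
    where
      exts-h : ∀ {B} (x : Nats (suc _) ∋ B) → sub sg (ρ ▹ π1 sg r) (exts sg σ x) ≡ (ρ' ▹ π1 sg r) x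
      exts-h here      = refl
      exts-h (there x) = trans (sub-▹-wk ρ _ (σ x)) (h x)

  Real-[]F : ∀ {n X} (ρ : Sub sg (Nats n) []) (A : Fm sg (suc n) X) (t : ArTm sg n) r →
             Realizes ρ (_[_]F sg A t) r ⇔ Realizes (ρ ▹ sub sg ρ t) A r
  Real-[]F ρ A t = Real-subF (var ▹ t) ρ (ρ ▹ sub sg ρ t) (λ { here → refl ; (there x) → refl }) A

module Soundness (sg : Sig) (S : Sys sg) (H : Assumptions sg S) (s : Tm sg [] State) where
  open Substitution sg
  open Reduction sg S
  open Conversion sg S H
  open Monad sg S H s
  open Realizability sg S H s
  open Assumptions H

  env : ∀ {n} → Vec ℕ n → Sub sg (Nats n) []
  env = numEnv sg S

  close : ∀ {n} {ns : Vec ℕ n} {Γ : Hyps sg n} → RealHyps sg S H s ns Γ → Sub sg (ctxOf sg Γ) []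
  close = closeSub sg S H

  ⊨_ : ∀ {n} {Γ : Hyps sg n} {X} {A : Fm sg n X} → Der sg S Γ A → Set
  ⊨ D = Valid sg S H D s

  Real-hyp : ∀ {n} {ns : Vec ℕ n} {Γ : Hyps sg n} {X} {A : Fm sg n X}
             (i : HVar sg Γ A) (ps : RealHyps sg S H s ns Γ) → Realizes (env ns) A (close ps (hv sg i))
  Real-hyp hz     (p ∷ ps) = p
  Real-hyp (hs i) (p ∷ ps) = Real-hyp i ps

  close-embN : ∀ {n} {ns : Vec ℕ n} {Γ : Hyps sg n} (ps : RealHyps sg S H s ns Γ) →
               ∀ {B} (x : Nats n ∋ B) → close ps (embN sg Γ x) ≡ env ns x
  close-embN []       x = refl
  close-embN (_ ∷ ps) x = close-embN ps x

  sub-close-embN : ∀ {n} {ns : Vec ℕ n} {Γ : Hyps sg n} (ps : RealHyps sg S H s ns Γ) (t : ArTm sg n) →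
                   sub sg (close ps) (ren sg (embN sg Γ) t) ≡ sub sg (env ns) t
  sub-close-embN ps = sub-ren (close-embN ps)

  env-∷ : ∀ {n} {ns : Vec ℕ n} {u m} → u ≈ num sg m → (env ns ▹ u) ~ env (m ∷ ns)
  env-∷ e = pointwise λ { here → e ; (there x) → ≈-refl _ }

  Real-wkF : ∀ {n X} m (ns : Vec ℕ n) (A : Fm sg n X) r →
             Realizes (env (m ∷ ns)) (wkF sg A) r ⇔ Realizes (env ns) A r
  Real-wkF m ns A = Real-subF (λ x → var (there x)) (env (m ∷ ns)) (env ns) (λ x → refl) A

  RealHyps-wk : ∀ {n} {ns : Vec ℕ n} {Γ : Hyps sg n} m → RealHyps sg S H s ns Γ →
                RealHyps sg S H s (m ∷ ns) (wkH sg Γ)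
  RealHyps-wk m []                         = []
  RealHyps-wk {ns = ns} m (_∷_ {A = A} p ps) = from (Real-wkF m ns A _) p ∷ RealHyps-wk m ps

  close-ρ∀ : ∀ {n} {ns : Vec ℕ n} {Γ : Hyps sg n} m (ps : RealHyps sg S H s ns Γ) →
             ∀ {B} (x : ctxOf sg (wkH sg Γ) ∋ B) →
             (close ps ▹ num sg m) (ρ∀ sg Γ x) ≡ close (RealHyps-wk m ps) x
  close-ρ∀ m []       here      = refl
  close-ρ∀ m []       (there x) = refl
  close-ρ∀ m (_ ∷ ps) here      = refl
  close-ρ∀ {Γ = _ ∷ Γ} m (_ ∷ ps) (there x) with ρ∀ sg Γ x | close-ρ∀ m ps x
  ... | here    | e = e
  ... | there y | e = e

  sub-close-∷ : ∀ {n} {ns : Vec ℕ n} {Γ : Hyps sg n} {X Y} (A : Fm sg n X) {p}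
                (q : Realizes (env ns) A p) (ps : RealHyps sg S H s ns Γ) (t : Tm sg (X ∷ ctxOf sg Γ) Y) →
                sub sg (close ps ▹ p) t ≡ sub sg (close (_∷_ {A = A} q ps)) t
  sub-close-∷ A q ps = sub-cong (λ { here → refl ; (there y) → refl })

  -- The decoration of ∨E weakens each branch λα. p past the binder γ of the scrutinee.
  branch-↠ : ∀ {Γ A B C} (σ : Sub sg Γ []) (r : Tm sg [] C) (p : Tm sg (A ∷ Γ) B) a →
             app (sub sg (σ ▹ r) (lam (ren sg (ext sg there) p))) a ↠ sub sg (σ ▹ a) p
  branch-↠ σ r p a = β-sub (σ ▹ r) (ren sg (ext sg there) p) a
                      ◅◅ ≡⇒↠ (sub-ren (λ { here → refl ; (there y) → refl }) p)

  idR-valid : ∀ {n} {Γ : Hyps sg n} {X} {A : Fm sg n X} (i : HVar sg Γ A) → ⊨ idR i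
  idR-valid i ns ps = inj₁ (_ , raise⁰-↠ _ , Real-hyp i ps)

  ∧I-valid : ∀ {n} {Γ : Hyps sg n} {X Y} {A : Fm sg n X} {B : Fm sg n Y}
               (d : Der sg S Γ A) (e : Der sg S Γ B) → ⊨ d → ⊨ e → ⊨ ∧I d e
  ∧I-valid {A = A} {B} _ _ vd ve ns ps =
    Proceeds-bind (raiseK-spec _ _ (Realizes (env ns) A ∷ Realizes (env ns) B ∷ []) (con pairc) _
                               (vd ns ps , ve ns ps , tt))
      λ { (a ∷ b ∷ []) (qa , qb , tt) →
            Outcome-inl (Real-backward A (one π₁β) qa , Real-backward B (one π₂β) qb) }

  ∧E₁-valid : ∀ {n} {Γ : Hyps sg n} {X Y} {A : Fm sg n X} {B : Fm sg n Y}
                (d : Der sg S Γ (A ∧' B)) → ⊨ d → ⊨ ∧E₁ d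
  ∧E₁-valid {A = A} {B} _ vd ns ps =
    Proceeds-bind (raiseK-spec _ _ (Realizes (env ns) (A ∧' B) ∷ []) (con π₁c) _ (vd ns ps , tt))
      λ { (_ ∷ []) (q , tt) → Outcome-inl (proj₁ q) }

  ∧E₂-valid : ∀ {n} {Γ : Hyps sg n} {X Y} {A : Fm sg n X} {B : Fm sg n Y}
                (d : Der sg S Γ (A ∧' B)) → ⊨ d → ⊨ ∧E₂ d
  ∧E₂-valid {A = A} {B} _ vd ns ps =
    Proceeds-bind (raiseK-spec _ _ (Realizes (env ns) (A ∧' B) ∷ []) (con π₂c) _ (vd ns ps , tt))
      λ { (_ ∷ []) (q , tt) → Outcome-inl (proj₂ q) }

  ∨I₁-valid : ∀ {n} {Γ : Hyps sg n} {X Y} {A : Fm sg n X} {B : Fm sg n Y}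
                (d : Der sg S Γ A) → ⊨ d → ⊨ ∨I₁ {B = B} d
  ∨I₁-valid {A = A} _ vd ns ps =
    Proceeds-bind (raiseK-spec _ _ (Realizes (env ns) A ∷ []) (con inlc) _ (vd ns ps , tt))
      λ { (a ∷ []) (q , tt) → Outcome-inl (inj₁ (a , ε , q)) }

  ∨I₂-valid : ∀ {n} {Γ : Hyps sg n} {X Y} {A : Fm sg n X} {B : Fm sg n Y}
                (d : Der sg S Γ B) → ⊨ d → ⊨ ∨I₂ {A = A} d
  ∨I₂-valid {B = B} _ vd ns ps =
    Proceeds-bind (raiseK-spec _ _ (Realizes (env ns) B ∷ []) (con inrc) _ (vd ns ps , tt))
      λ { (b ∷ []) (q , tt) → Outcome-inl (inj₂ (b , ε , q)) }

  ∨E-valid : ∀ {n} {Γ : Hyps sg n} {X Y Z} {A : Fm sg n X} {B : Fm sg n Y} {C : Fm sg n Z}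
               (d : Der sg S Γ (A ∨' B)) (p : Der sg S ((X , A) ∷ Γ) C) (q : Der sg S ((Y , B) ∷ Γ) C) →
               ⊨ d → ⊨ p → ⊨ q → ⊨ ∨E d p q
  ∨E-valid {A = A} {B} {C} _ p q vd vp vq ns ps =
    Proceeds-bind (starM-spec _ _ (vd ns ps)) λ where
      r (inj₁ (a , r⇝a , qa)) →
        Proceeds-backward (↠-appˡ (β-sub σ cases r ◅◅ ↠-case r⇝a ◅◅ caseL ◅ branch-↠ σ r (dec sg S p) a
                                   ◅◅ ≡⇒↠ (sub-close-∷ A qa ps (dec sg S p))))
                          (vp ns (qa ∷ ps))
      r (inj₂ (b , r⇝b , qb)) →
        Proceeds-backward (↠-appˡ (β-sub σ cases r ◅◅ ↠-case r⇝b ◅◅ caseR ◅ branch-↠ σ r (dec sg S q) b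
                                   ◅◅ ≡⇒↠ (sub-close-∷ B qb ps (dec sg S q))))
                          (vq ns (qb ∷ ps))
    where
      σ = close ps
      cases = case sg (v0 sg) (lam (ren sg (ext sg there) (dec sg S p))) (lam (ren sg (ext sg there) (dec sg S q)))

  ⟹I-valid : ∀ {n} {Γ : Hyps sg n} {X Y} {A : Fm sg n X} {B : Fm sg n Y}
               (d : Der sg S ((X , A) ∷ Γ) B) → ⊨ d → ⊨ ⟹I d
  ⟹I-valid {A = A} d vd ns ps =
    inj₁ (_ , raise⁰-↠ _ , λ p x →
      Proceeds-backward (↠-appˡ (β-sub (close ps) (dec sg S d) p
                                 ◅◅ ≡⇒↠ (sub-close-∷ A x ps (dec sg S d))))
                        (vd ns (x ∷ ps)))

  ⟹E-valid : ∀ {n} {Γ : Hyps sg n} {X Y} {A : Fm sg n X} {B : Fm sg n Y}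
               (d : Der sg S Γ (A ⟹ B)) (e : Der sg S Γ A) → ⊨ d → ⊨ e → ⊨ ⟹E d e
  ⟹E-valid {A = A} {B} _ _ vd ve ns ps =
    Proceeds-bind (starK-spec _ _ (Realizes (env ns) (A ⟹ B) ∷ Realizes (env ns) A ∷ [])
                              (lam (lam (app (v1 sg) (v0 sg)))) _ (vd ns ps , ve ns ps , tt))
      λ { (f ∷ a ∷ []) (qf , qa , tt) →
            Proceeds-backward (↠-appˡ (↠-appˡ (one β) ◅◅ step≡ β (cong (λ w → app w a) (wk-[] a f))))
                              (qf a qa) }

  ∀I-valid : ∀ {n} {Γ : Hyps sg n} {X} {A : Fm sg (suc n) X} (d : Der sg S (wkH sg Γ) A) → ⊨ d → ⊨ ∀I d
  ∀I-valid {Γ = Γ} {A = A} d vd ns ps =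
    inj₁ (_ , raise⁰-↠ _ , λ m →
      Outcome-map (Real-~ (~-sym (env-∷ (≈-refl (num sg m)))) A)
        (Proceeds-backward (↠-appˡ (β-sub (close ps) (ren sg (ρ∀ sg Γ) (dec sg S d)) (num sg m)
                                    ◅◅ ≡⇒↠ (sub-ren (close-ρ∀ m ps) (dec sg S d))))
                           (vd (m ∷ ns) (RealHyps-wk m ps))))

  ∀E-valid : ∀ {n} {Γ : Hyps sg n} {X} {A : Fm sg (suc n) X} (d : Der sg S Γ (fall A)) (t : ArTm sg n) →
             ⊨ d → ⊨ ∀E d t
  ∀E-valid {Γ = Γ} {A = A} _ t vd ns ps with NUM (sub sg (env ns) t)
  ... | k , t⇝k =
    Proceeds-bind (starM-spec _ _ (vd ns ps)) λ r qr →
      Proceeds-backward (↠-appˡ (β-sub σ (app (v0 sg) (wk sg t′)) r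
                                 ◅◅ ≡⇒↠ (cong (app r) (trans (sub-▹-wk σ r t′) (sub-close-embN ps t)))
                                 ◅◅ ↠-appʳ t⇝k))
        (Outcome-map (λ a x → from (Real-[]F (env ns) A t a)
                                   (Real-~ (~-▹ (~-refl (env ns)) (≈-sym (↠⇒≈ t⇝k))) A a x))
                     (qr k))
    where
      σ = close ps
      t′ = ren sg (embN sg Γ) t

  ∃I-valid : ∀ {n} {Γ : Hyps sg n} {X} {A : Fm sg (suc n) X} (t : ArTm sg n)
               (d : Der sg S Γ (_[_]F sg A t)) → ⊨ d → ⊨ ∃I t d
  ∃I-valid {Γ = Γ} {A = A} t _ vd ns ps =
    Proceeds-bind (raiseK-spec _ _ (Realizes (env ns) (_[_]F sg A t) ∷ []) _ _ (vd ns ps , tt))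
      λ { (a ∷ []) (q , tt) →
            Outcome-inl (Real-fex-intro A
              (β-sub (close ps) (pair sg (wk sg t′) (v0 sg)) a
               ◅◅ ≡⇒↠ (cong (λ w → pair sg w a) (trans (sub-▹-wk (close ps) a t′) (sub-close-embN ps t))))
              (to (Real-[]F (env ns) A t a) q)) }
    where
      t′ = ren sg (embN sg Γ) t

  ▹-ins1 : ∀ {Γ A B C} (σ : Sub sg Γ []) (r : Tm sg [] B) (u : Tm sg [] A) (x : (A ∷ Γ) ∋ C) →
           ((σ ▹ r) ▹ u) (ins1 sg x) ≡ (σ ▹ u) x
  ▹-ins1 σ r u here      = refl
  ▹-ins1 σ r u (there x) = refl

  ∃E-valid : ∀ {n} {Γ : Hyps sg n} {X Y} {A : Fm sg (suc n) X} {C : Fm sg n Y}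
               (d : Der sg S Γ (fex A)) (e : Der sg S ((X , A) ∷ wkH sg Γ) (wkF sg C)) →
               ⊨ d → ⊨ e → ⊨ ∃E d e
  ∃E-valid {Γ = Γ} {A = A} {C} _ e vd ve ns ps =
    Proceeds-bind (starM-spec _ _ (vd ns ps)) λ r qr →
      let k , π₁r⇝k = NUM (π1 sg r)
          qA = Real-~ (env-∷ (k , π₁r⇝k , ε)) A _ qr
      in Proceeds-backward (↠-appˡ (unpack r π₁r⇝k ◅◅ ≡⇒↠ (sub-ren (close-unpacked r k qA) (dec sg S e))))
           (Outcome-map (λ c → to (Real-wkF k ns C c)) (ve (k ∷ ns) (qA ∷ RealHyps-wk k ps)))
    where
      σ = close ps
      body = ren sg (ext sg (λ x → ins1 sg (ρ∀ sg Γ x))) (dec sg S e)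
      unpack : ∀ r {k} → π1 sg r ↠ num sg k →
               app (sub sg σ (lam (app (app (lam (lam body)) (π1 sg (v0 sg))) (π2 sg (v0 sg))))) r ↠
               sub sg (((σ ▹ r) ▹ num sg k) ▹ π2 sg r) body
      unpack r {k} red =
        β-sub σ (app (app (lam (lam body)) (π1 sg (v0 sg))) (π2 sg (v0 sg))) r
        ◅◅ ↠-appˡ (↠-appʳ red) ◅◅ ↠-appˡ (β-sub (σ ▹ r) (lam body) (num sg k))
        ◅◅ β-sub ((σ ▹ r) ▹ num sg k) body (π2 sg r)
      close-unpacked : ∀ r k qA → ∀ {B} (x : ctxOf sg ((_ , A) ∷ wkH sg Γ) ∋ B) →
                       (((σ ▹ r) ▹ num sg k) ▹ π2 sg r) (ext sg (λ x → ins1 sg (ρ∀ sg Γ x)) x) ≡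
                       close (_∷_ {A = A} qA (RealHyps-wk k ps)) x
      close-unpacked r k qA here      = refl
      close-unpacked r k qA (there y) = trans (▹-ins1 σ r (num sg k) (ρ∀ sg Γ y)) (close-ρ∀ k ps y)

  num-↠-lt : ∀ {z k a b} → num sg z ↠ num sg a → num sg k ↠ num sg b →
             Sys.⟦_⟧ S (Sig.lt sg) (a ∷ b ∷ []) → z < k
  num-↠-lt z⇝a k⇝b a<b with UNIQ z⇝a ε | UNIQ k⇝b ε
  ... | refl | refl = lt-sound _ _ a<b

  ind-valid : ∀ {n} {Γ : Hyps sg n} {X} {A : Fm sg (suc n) X}
                (d : Der sg S ((_ , IH sg A) ∷ wkH sg Γ) A) → ⊨ d → ⊨ ind d
  ind-valid {Γ = Γ} {X} {A} d vd ns ps = inj₁ (_ , raise⁰-↠ _ , λ k → <-rec Bounded step k ∞ tt)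
    where
      σ = close ps
      body = ren sg (ext sg (λ x → there (ρ∀ sg Γ x))) (dec sg S d)
      ih = app (raiseK sg [] (Unit ⇒ T X)) (lam (app (v2 sg) (v1 sg)))
      f = sub sg σ (lam (lam (app (lam body) (lam ih))))
      rec : ℕ → Tm sg [] (Nat ⇒ T X)
      rec k = app (con (recc (fin k))) f
      τ : ℕ → Sub sg _ []
      τ k = (σ ▹ num sg k) ▹ rec k
      -- R_N f k̄ unfolds only for k < N, so soundness is proved for every such bound at once.
      Bounded : ℕ → Set
      Bounded k = ∀ N → k <∞ N →
                  Outcome (Realizes (env ns ▹ num sg k) A) (app (app (app (con (recc N)) f) (num sg k)) s)
      hyp : ∀ k → (∀ {j} → j < k → Bounded j) → Realizes (env (k ∷ ns)) (IH sg A) (sub sg (τ k) (lam ih))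
      hyp k below z =
        inj₁ (_ , ↠-appˡ (β-sub (τ k) ih (num sg z)) ◅◅ raise⁰-↠ _ ,
              λ { p (_ , (_ ∷ _ ∷ []) , (z⇝a ∷ k⇝b ∷ []) , a<b) →
                    let z<k = num-↠-lt z⇝a k⇝b a<b in
                    Outcome-map (λ r → from (Real-subF _ _ _ (λ { here → refl ; (there x) → refl }) A r))
                      (Proceeds-backward (↠-appˡ (β-sub (τ k ▹ num sg z) (app (v2 sg) (v1 sg)) p))
                                         (below z<k (fin k) z<k)) })
      step : ∀ k → (∀ {j} → j < k → Bounded j) → Bounded k
      step k below N k<N =
        Outcome-map (Real-~ (~-sym (env-∷ (≈-refl (num sg k)))) A)
          (Proceeds-backward
            (↠-appˡ (one (recS k k<N) ◅◅ ↠-appˡ (β-sub σ (lam (app (lam body) (lam ih))) (num sg k))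
                     ◅◅ β-sub (σ ▹ num sg k) (app (lam body) (lam ih)) (rec k)
                     ◅◅ β-sub (τ k) body (sub sg (τ k) (lam ih))
                     ◅◅ ≡⇒↠ (sub-ren (λ { here → refl ; (there y) → close-ρ∀ k ps y }) (dec sg S d))))
            (vd (k ∷ ns) (hyp k below ∷ RealHyps-wk k ps)))

  sub-lamsU : ∀ {Γ Δ} (σ : Sub sg Γ Δ) l → sub sg σ (lamsU sg S l) ≡ lamsU sg S l
  sub-lamsU σ zero    = refl
  sub-lamsU σ (suc l) = cong lam (sub-lamsU (exts sg σ) l)

  sub-appsT : ∀ {Γ Δ B} (σ : Sub sg Γ Δ) l (f : Tm sg Γ (mapT (replicate l Unit) ⇛ B))
              (rs : Vec (Tm sg Γ (T Unit)) l) →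
              sub sg σ (appsT sg S l f rs) ≡ appsT sg S l (sub sg σ f) (V.map (sub sg σ) rs)
  sub-appsT σ zero    f []       = refl
  sub-appsT σ (suc l) f (r ∷ rs) = sub-appsT σ l (app f r) rs

  toArgs : ∀ {l} → Vec (Tm sg [] (T Unit)) l → Args (mapT (replicate l Unit))
  toArgs []       = []
  toArgs (r ∷ rs) = r ∷ toArgs rs

  appsT-appArgs : ∀ {B} l (f : Tm sg [] (mapT (replicate l Unit) ⇛ B)) (rs : Vec (Tm sg [] (T Unit)) l) →
                  appsT sg S l f rs ≡ appArgs f (toArgs rs)
  appsT-appArgs zero    f []       = refl
  appsT-appArgs (suc l) f (r ∷ rs) = appsT-appArgs l (app f r) rs

  lamsU-↠ : ∀ l (as : Args (replicate l Unit)) → appArgs (lamsU sg S l) as ↠ con unitc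
  lamsU-↠ zero    []       = ε
  lamsU-↠ (suc l) (a ∷ as) = ↠-appArgs as (step≡ β (sub-lamsU (var ▹ a) l)) ◅◅ lamsU-↠ l as

  atomPreds : ∀ {n} → Sub sg (Nats n) [] → (Ps : List (Atom sg n)) → Preds (replicate (length Ps) Unit)
  atomPreds ρ []       = []
  atomPreds ρ (P ∷ Ps) = Realizes ρ (at P) ∷ atomPreds ρ Ps

  Holds-atomPreds : ∀ {n} (ρ : Sub sg (Nats n) []) (Ps : List (Atom sg n))
                    (as : Args (replicate (length Ps) Unit)) →
                    Holds (atomPreds ρ Ps) as → All (TrueA sg S ρ) Ps
  Holds-atomPreds ρ []       []       tt              = []
  Holds-atomPreds ρ (P ∷ Ps) (a ∷ as) ((_ , p) , ok) = p ∷ Holds-atomPreds ρ Ps as ok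

  ⊨*_ : ∀ {n} {Γ : Hyps sg n} {Ps} → Ders sg S Γ Ps → Set
  ⊨*_ {Γ = Γ} {Ps} ds = ∀ ns (ps : RealHyps sg S H s ns Γ) →
    HoldsT (atomPreds (env ns) Ps) (toArgs (V.map (sub sg (close ps)) (decs sg S ds)))

  atmR-valid : ∀ {n} {Γ : Hyps sg n} {Ps P} (r : Sys.Rule S n Ps P) (ds : Ders sg S Γ Ps) →
               ⊨* ds → ⊨ atmR r ds
  atmR-valid {Ps = Ps} r ds vds ns ps =
    Proceeds-backward (≡⇒↠ (cong (λ w → app w s) unfold))
      (Proceeds-bind (raiseK-spec (replicate l Unit) Unit (atomPreds (env ns) Ps) (lamsU sg S l) _ (vds ns ps))
        λ as q → Outcome-inl (lamsU-↠ l as , rule-sound r ns (Holds-atomPreds (env ns) Ps as q)))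
    where
      l = length Ps
      σ = close ps
      unfold : sub sg σ (dec sg S (atmR r ds)) ≡
               appArgs (app (raiseK sg (replicate l Unit) Unit) (lamsU sg S l))
                       (toArgs (V.map (sub sg σ) (decs sg S ds)))
      unfold = begin
        sub sg σ (appsT sg S l (app (raiseK sg (replicate l Unit) Unit) (lamsU sg S l)) (decs sg S ds))
          ≡⟨ sub-appsT σ l _ (decs sg S ds) ⟩
        appsT sg S l (app (sub sg σ (raiseK sg (replicate l Unit) Unit)) (sub sg σ (lamsU sg S l)))
                     (V.map (sub sg σ) (decs sg S ds))
          ≡⟨ cong₂ (λ g u → appsT sg S l (app g u) (V.map (sub sg σ) (decs sg S ds)))
                   (sub-raiseK σ (replicate l Unit) Unit) (sub-lamsU σ l) ⟩
        appsT sg S l (app (raiseK sg (replicate l Unit) Unit) (lamsU sg S l)) (V.map (sub sg σ) (decs sg S ds))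
          ≡⟨ appsT-appArgs l _ _ ⟩
        appArgs (app (raiseK sg (replicate l Unit) Unit) (lamsU sg S l)) (toArgs (V.map (sub sg σ) (decs sg S ds)))
          ∎
        where open ≡-Reasoning

  values : ∀ {k} (us : Vec (Tm sg [] Nat) k) → Σ (Vec ℕ k) (Pointwise Evaluates us)
  values []       = [] , []
  values (u ∷ us) = let v , r = NUM u ; vs , rs = values us in v ∷ vs , r ∷ rs

  values-∷ʳ : ∀ {k} {us : Vec (Tm sg [] Nat) k} {vs : Vec ℕ k} {ws u m} →
              Pointwise Evaluates us vs → Pointwise Evaluates (us ∷ʳ u) ws → u ↠ num sg m → ws ≡ vs ∷ʳ m
  values-∷ʳ []       (r ∷ [])   u⇝m = cong (_∷ []) (UNIQ r u⇝m)
  values-∷ʳ (r ∷ rs) (r' ∷ rs') u⇝m = cong₂ _∷_ (UNIQ r' r) (values-∷ʳ rs rs' u⇝m)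

  ↠-appsNˡ : ∀ {k B} {f f' : Tm sg [] (NatsArr k B)} (us : Vec (Tm sg [] Nat) k) →
             f ↠ f' → appsN sg f us ↠ appsN sg f' us
  ↠-appsNˡ []       r = r
  ↠-appsNˡ (u ∷ us) r = ↠-appsNˡ us (↠-appˡ r)

  ↠-appsN : ∀ {k B} (f : Tm sg [] (NatsArr k B)) {us : Vec (Tm sg [] Nat) k} {vs} →
            Pointwise Evaluates us vs → appsN sg f us ↠ appsN sg f (V.map (num sg) vs)
  ↠-appsN f []                = ε
  ↠-appsN f {_ ∷ us} (r ∷ rs) = ↠-appsNˡ us (↠-appʳ r) ◅◅ ↠-appsN (app f _) rs

  map-sub-wk-∷ʳ : ∀ {n k} (ρ : Sub sg (Nats n) []) (ts : Vec (ArTm sg n) k) (u : Tm sg [] Nat) →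
                  V.map (sub sg (ρ ▹ u)) (V.map (wk sg) ts ∷ʳ v0 sg) ≡ V.map (sub sg ρ) ts ∷ʳ u
  map-sub-wk-∷ʳ ρ ts u = trans (VP.map-∷ʳ (sub sg (ρ ▹ u)) (v0 sg) (V.map (wk sg) ts))
                               (cong (_∷ʳ u) (map-map (sub-▹-wk ρ u) ts))

  module _ {n k} {Γ : Hyps sg n} (P : Sig.PSym sg k) (ts : Vec (ArTm sg n) k)
           (ns : Vec ℕ n) (ps : RealHyps sg S H s ns Γ) where
    private
      σ : Sub sg (ctxOf sg Γ) []
      σ = close ps
      ρ : Sub sg (Nats n) []
      ρ = env ns
      emb : ArTm sg n → Tm sg (ctxOf sg Γ) Nat
      emb = ren sg (embN sg Γ)
      vs : Vec ℕ k
      vs = proj₁ (values (V.map (sub sg ρ) ts))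
      vs-eval : Pointwise Evaluates (V.map (sub sg ρ) ts) vs
      vs-eval = proj₂ (values (V.map (sub sg ρ) ts))
      query : Tm sg (State ∷ ctxOf sg Γ) (Unit ⊕ Nat)
      query = appsN sg (app (con (queryc P)) (v0 sg)) (V.map (λ t → wk sg (emb t)) ts)
      emb⁴ : ArTm sg n → Tm sg (State ∷ Nat ∷ Unit ∷ State ∷ ctxOf sg Γ) Nat
      emb⁴ t = wk sg (wk sg (wk sg (wk sg (emb t))))
      evaluate : Tm sg (State ∷ Nat ∷ Unit ∷ State ∷ ctxOf sg Γ) (Unit ⊕ Ex)
      evaluate = app (appsN sg (con (evalc P)) (V.map emb⁴ ts)) (v1 sg)
      σ₂ : Sub sg (Unit ∷ State ∷ ctxOf sg Γ) []
      σ₂ = (σ ▹ s) ▹ con unitc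
      P-ts-y : Atom sg (suc n)
      P-ts-y = pr P (V.map (wk sg) ts ∷ʳ v0 sg)

    query-↠ : sub sg (σ ▹ s) query ↠ queryT sg P s vs
    query-↠ =
      ≡⇒↠ (trans (sub-appsN (σ ▹ s) (app (con (queryc P)) (v0 sg)) (V.map (λ t → wk sg (emb t)) ts))
                 (cong (appsN sg (app (con (queryc P)) s))
                       (map-map (λ t → trans (sub-▹-wk σ s (emb t)) (sub-close-embN ps t)) ts)))
      ◅◅ ↠-appsN (app (con (queryc P)) s) vs-eval

    eval-↠ : ∀ m → app (app (sub sg σ₂ (lam (lam evaluate))) (num sg m)) s ↠ evalT sg P vs m
    eval-↠ m =
      ↠-appˡ (β-sub σ₂ (lam evaluate) (num sg m)) ◅◅ β-sub (σ₂ ▹ num sg m) evaluate s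
      ◅◅ ≡⇒↠ (cong (λ w → app w (num sg m))
                (trans (sub-appsN ((σ₂ ▹ num sg m) ▹ s) (con (evalc P)) (V.map emb⁴ ts))
                       (cong (appsN sg (con (evalc P))) (map-map sub-wk⁴ ts))))
      ◅◅ ↠-appˡ (↠-appsN (con (evalc P)) vs-eval)
      where
        sub-wk⁴ : ∀ t → sub sg ((σ₂ ▹ num sg m) ▹ s) (emb⁴ t) ≡ sub sg ρ t
        sub-wk⁴ t = begin
          sub sg ((σ₂ ▹ num sg m) ▹ s) (emb⁴ t)
            ≡⟨ sub-▹-wk (σ₂ ▹ num sg m) s (wk sg (wk sg (wk sg (emb t)))) ⟩
          sub sg (σ₂ ▹ num sg m) (wk sg (wk sg (wk sg (emb t))))
            ≡⟨ sub-▹-wk σ₂ (num sg m) (wk sg (wk sg (emb t))) ⟩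
          sub sg σ₂ (wk sg (wk sg (emb t)))
            ≡⟨ sub-▹-wk (σ ▹ s) (con unitc) (wk sg (emb t)) ⟩
          sub sg (σ ▹ s) (wk sg (emb t))
            ≡⟨ sub-▹-wk σ s (emb t) ⟩
          sub sg σ (emb t)
            ≡⟨ sub-close-embN ps t ⟩
          sub sg ρ t
            ∎
          where open ≡-Reasoning

    ∀-branch : queryT sg P s vs ↠ inl sg (con unitc) →
               Realizes ρ (fall (at P-ts-y)) (sub sg σ₂ (lam (lam evaluate)))
    ∀-branch q m with eval-total P vs m
    ... | inj₁ ok        =
      inj₁ (con unitc , eval-↠ m ◅◅ ok , ε , vs ∷ʳ m ,
            subst (λ v → Pointwise Evaluates v (vs ∷ʳ m)) (sym (map-sub-wk-∷ʳ ρ ts (num sg m)))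
                  (Pointwise-∷ʳ vs-eval ε) ,
            IR2 P vs m ok)
    ... | inj₂ (e , err) = inj₂ (e , eval-↠ m ◅◅ err , IR3 P s vs m e q err)

    ∃-branch : ∀ m → queryT sg P s vs ↠ inr sg (num sg m) →
               Realizes ρ (fex (¬' sg (at P-ts-y))) (pair sg (num sg m) (unitM sg))
    ∃-branch m q _ (_ , ws , pw , holds) =
      ⊥-elim (IR1 P s vs m q (subst (Sys.⟦_⟧ S P) (values-∷ʳ vs-eval pw′ (one π₁β)) holds))
      where pw′ = subst (λ v → Pointwise Evaluates v ws) (map-sub-wk-∷ʳ ρ ts _) pw

    EMF-realized : Realizes ρ (EMF sg P ts)
                    (case sg (sub sg (σ ▹ s) query) (sub sg (σ ▹ s) (lam (inl sg (lam (lam evaluate)))))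
                             (sub sg (σ ▹ s) (lam (inr sg (pair sg (v0 sg) (unitM sg))))))
    EMF-realized with query-total P s vs
    ... | inj₁ q =
      inj₁ (_ , ↠-case (query-↠ ◅◅ q) ◅◅ caseL ◅
                β-sub (σ ▹ s) (inl sg (lam (lam evaluate))) (con unitc) ,
            ∀-branch q)
    ... | inj₂ (m , q) =
      inj₂ (_ , ↠-case (query-↠ ◅◅ q) ◅◅ caseR ◅
                β-sub (σ ▹ s) (inr sg (pair sg (v0 sg) (unitM sg))) (num sg m) ,
            ∃-branch m q)

    em-run : Outcome (Realizes ρ (EMF sg P ts)) (app (sub sg σ (dec sg S (em {Γ = Γ} P ts))) s)
    em-run = inj₁ (_ , β-sub σ (lamBody (dec sg S (em {Γ = Γ} P ts))) s , EMF-realized)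

  em-valid : ∀ {n k} {Γ : Hyps sg n} (P : Sig.PSym sg k) (ts : Vec (ArTm sg n) k) → ⊨ em {Γ = Γ} P ts
  em-valid P ts ns ps = em-run P ts ns ps

  valid  : ∀ {n} {Γ : Hyps sg n} {X} {A : Fm sg n X} (D : Der sg S Γ A) → ⊨ D
  valids : ∀ {n} {Γ : Hyps sg n} {Ps} (ds : Ders sg S Γ Ps) → ⊨* ds

  valids []       ns ps = tt
  valids (d ∷ ds) ns ps = valid d ns ps , valids ds ns ps

  valid (idR i)      = idR-valid i
  valid (atmR r ds)  = atmR-valid r ds (valids ds)
  valid (∧I d e)     = ∧I-valid d e (valid d) (valid e)
  valid (∧E₁ d)      = ∧E₁-valid d (valid d)
  valid (∧E₂ d)      = ∧E₂-valid d (valid d)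
  valid (∨I₁ {B = B} d) = ∨I₁-valid {B = B} d (valid d)
  valid (∨I₂ {A = A} d) = ∨I₂-valid {A = A} d (valid d)
  valid (∨E d p q)   = ∨E-valid d p q (valid d) (valid p) (valid q)
  valid (⟹I d)       = ⟹I-valid d (valid d)
  valid (⟹E d e)     = ⟹E-valid d e (valid d) (valid e)
  valid (∀I d)       = ∀I-valid d (valid d)
  valid (∀E d t)     = ∀E-valid d t (valid d)
  valid (∃I t d)     = ∃I-valid t d (valid d)
  valid (∃E d e)     = ∃E-valid d e (valid d) (valid e)
  valid (ind d)      = ind-valid d (valid d)
  valid (em P ts)    = em-valid P ts

mainTheorem4 : (sg : Sig) (S : Sys sg) (H : Assumptions sg S)
               {n : ℕ} {Γ : Hyps sg n} {X : Ty} {A : Fm sg n X}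
               (D : Der sg S Γ A) (s : Tm sg [] State) →
               Valid sg S H D s
mainTheorem4 sg S H D s = Soundness.valid sg S H s D
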